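{- Let $S_2(3)$ be the point-line geometry defined in the context. Then $S_2(3)$ has exactly $40$ geometric hyperplanes: $16$ singular hyperplanes (each the union of the two lines through a point) and $24$ ovoids (sets of four pairwise non-collinear points), and each of these $40$ hyperplanes is projective. Moreover, $S_2(3)$ has exactly $136$ Veldkamp lines; exactly $130$ of them are projective, and the $40$ geometric hyperplanes together with these $130$ projective Veldkamp lines form a point-line geometry isomorphic to the projective space $\mathrm{PG}(3,3)$. The remaining $6$ Veldkamp lines are non-projective, and each of them consists of four pairwise disjoint ovoids.
   Context: For $k\ge 1$, $S_k(3)$ denotes the Segre variety $\mathrm{PG}(1,3)\times\cdots\times\mathrm{PG}(1,3)$ ($k$ factors), viewed as a point-line incidence structure: its points are the $k$-tuples $([x_1],\dots,[x_k])$ of points of the projective line $\mathrm{PG}(1,3)$ (which has $4$ points), and its lines are the sets of $4$ points obtained by letting one coordinate run over all of $\mathrm{PG}(1,3)$ while the other $k-1$ coordinates are fixed. A geometric hyperplane of $S_k(3)$ is a proper subset $H$ of the point set such that every line either is contained in $H$ or meets $H$ in exactly one point. A Veldkamp line of $S_k(3)$ is a set $\{h_1,h_2,h_3,h_4\}$ of four distinct geometric hyperplanes such that $h_i\cap h_j$ is the same set for all $i\neq j$ and $h_1\cup h_2\cup h_3\cup h_4$ is the whole point set. Via the Segre embedding $([x_1],\dots,[x_k])\mapsto[x_1\otimes\cdots\otimes x_k]$, $S_k(3)$ is identified with a set of points of $\mathrm{PG}(2^k-1,3)=\mathbb{P}((\mathrm{GF}(3)^2)^{\otimes k})$. A geometric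 hyperplane is called projective if it equals the intersection of (the image of) $S_k(3)$ with a hyperplane of $\mathrm{PG}(2^k-1,3)$, and non-projective otherwise. A Veldkamp line $\{h_1,\dots,h_4\}$ is called projective if $h_i=S_k(3)\cap\Pi_i$ for the four hyperplanes $\Pi_1,\dots,\Pi_4$ of $\mathrm{PG}(2^k-1,3)$ containing a common subspace of codimension $2$, and non-projective otherwise. -}

module Defs where

open import Data.Bool using (Bool; true; false)
open import Data.Fin using (Fin; zero; suc)
open import Data.Vec using (Vec; []; _∷_; lookup; zipWith; map; replicate)
open import Data.Product using (Σ; ∃; _×_; _,_; ∃-syntax)
open import Data.Sum using (_⊎_)
open import Relation.Binary.PropositionalEquality using (_≡_; _≢_)
open import Relation.Nullary using (¬_)
open import Function.Bundles using (_⇔_)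

data F3 : Set where
  𝟎 𝟏 𝟐 : F3

_+₃_ : F3 → F3 → F3
𝟎 +₃ y = y
𝟏 +₃ 𝟎 = 𝟏
𝟏 +₃ 𝟏 = 𝟐
𝟏 +₃ 𝟐 = 𝟎
𝟐 +₃ 𝟎 = 𝟐
𝟐 +₃ 𝟏 = 𝟎
𝟐 +₃ 𝟐 = 𝟏

_*₃_ : F3 → F3 → F3
𝟎 *₃ y = 𝟎
𝟏 *₃ y = y
𝟐 *₃ 𝟎 = 𝟎
𝟐 *₃ 𝟏 = 𝟐
𝟐 *₃ 𝟐 = 𝟏

-- The vector space GF(3)^4 = GF(3)^2 ⊗ GF(3)^2, ambient space of PG(3,3)

V4 : Set
V4 = Vec F3 4

zero4 : V4
zero4 = replicate 4 𝟎

_⊕_ : V4 → V4 → V4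
_⊕_ = zipWith _+₃_

_·_ : F3 → V4 → V4
α · v = map (α *₃_) v

dot : V4 → V4 → F3
dot (c₀ ∷ c₁ ∷ c₂ ∷ c₃ ∷ []) (v₀ ∷ v₁ ∷ v₂ ∷ v₃ ∷ []) =
  ((c₀ *₃ v₀) +₃ (c₁ *₃ v₁)) +₃ ((c₂ *₃ v₂) +₃ (c₃ *₃ v₃))

Independent : V4 → V4 → Set
Independent u w = ∀ (α β : F3) → (α · u) ⊕ (β · w) ≡ zero4 → (α ≡ 𝟎 × β ≡ 𝟎)

-- v and w span the same 1-dimensional subspace (same point of PG(3,3))
Proportional : V4 → V4 → Set
Proportional v w = Σ F3 λ α → α ≢ 𝟎 × v ≡ α · w

OnCommonPGLine : (Fin 4 → V4) → Set
OnCommonPGLine g = Σ V4 λ u → Σ V4 λ w → Independent u w ×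
  (∀ i → Σ F3 λ α → Σ F3 λ β → g i ≡ (α · u) ⊕ (β · w))

PG1 : Set
PG1 = Fin 4

rep : PG1 → F3 × F3
rep zero = 𝟏 , 𝟎
rep (suc zero) = 𝟎 , 𝟏
rep (suc (suc zero)) = 𝟏 , 𝟏
rep (suc (suc (suc zero))) = 𝟏 , 𝟐

Point : Set
Point = PG1 × PG1

-- Segre embedding: ([x],[y]) ↦ [x ⊗ y], coordinates (x0y0, x0y1, x1y0, x1y1)
seg : Point → V4
seg (a , b) with rep a | rep b
... | x₀ , x₁ | y₀ , y₁ =
  (x₀ *₃ y₀) ∷ (x₀ *₃ y₁) ∷ (x₁ *₃ y₀) ∷ (x₁ *₃ y₁) ∷ []

data Line : Set where
  firstVaries  : PG1 → Line
  secondVaries : PG1 → Line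

OnLine : Point → Line → Set
OnLine (a , b) (firstVaries b′)  = b ≡ b′
OnLine (a , b) (secondVaries a′) = a ≡ a′

Collinear : Point → Point → Set
Collinear p q = Σ Line λ L → OnLine p L × OnLine q L

Sub : Set
Sub = Vec (Vec Bool 4) 4

_∈ₛ_ : Point → Sub → Set
(a , b) ∈ₛ H = lookup (lookup H a) b ≡ true

IsGeomHyperplane : Sub → Set
IsGeomHyperplane H =
  (Σ Point λ p → ¬ (p ∈ₛ H)) ×
  (∀ (L : Line) →
     (∀ q → OnLine q L → q ∈ₛ H) ⊎
     (Σ Point λ p → OnLine p L × p ∈ₛ H × (∀ q → OnLine q L → q ∈ₛ H → q ≡ p)))

IsSingular : Sub → Set
IsSingular H = Σ Point λ p → ∀ q → (q ∈ₛ H ⇔ (Σ Line λ L → OnLine p L × OnLine q L))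

IsOvoid : Sub → Set
IsOvoid H =
  (Σ (Fin 4 → Point) λ e → (∀ i j → e i ≡ e j → i ≡ j) ×
     (∀ q → (q ∈ₛ H ⇔ (Σ (Fin 4) λ i → e i ≡ q)))) ×
  (∀ p q → p ∈ₛ H → q ∈ₛ H → p ≢ q → ¬ Collinear p q)

IsProjectiveHyperplane : Sub → Set
IsProjectiveHyperplane H = Σ V4 λ c → c ≢ zero4 ×
  (∀ p → (p ∈ₛ H ⇔ dot c (seg p) ≡ 𝟎))

-- Veldkamp lines, given by a labelling h : Fin 4 → Sub of their four members

IsVeldkampLine : (Fin 4 → Sub) → Set
IsVeldkampLine h =
  (∀ i → IsGeomHyperplane (h i)) ×
  (∀ i j → i ≢ j → h i ≢ h j) ×
  (∀ i j k l → i ≢ j → k ≢ l → ∀ p →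
     ((p ∈ₛ h i × p ∈ₛ h j) ⇔ (p ∈ₛ h k × p ∈ₛ h l))) ×
  (∀ p → Σ (Fin 4) λ i → p ∈ₛ h i)

-- h i = S ∩ Π_i with Π_i = {v | dot (f i) v = 0} hyperplanes of PG(3,3)
-- all containing the codimension-2 subspace (projective line) span(u,w)
IsProjectiveVeldkampLine : (Fin 4 → Sub) → Set
IsProjectiveVeldkampLine h =
  Σ V4 λ u → Σ V4 λ w → Independent u w ×
  Σ (Fin 4 → V4) λ f → ∀ i →
    f i ≢ zero4 × dot (f i) u ≡ 𝟎 × dot (f i) w ≡ 𝟎 ×
    (∀ p → (p ∈ₛ h i ⇔ dot (f i) (seg p) ≡ 𝟎))

SameSet : (Fin 4 → Sub) → (Fin 4 → Sub) → Set
SameSet h h′ = (∀ i → Σ (Fin 4) λ j → h i ≡ h′ j) × (∀ j → Σ (Fin 4) λ i → h′ j ≡ h i)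

-- Under the Segre embedding S₂(3) is the hyperbolic quadric x₀x₃ = x₁x₂ of PG(3,3), and every
-- hyperplane of PG(3,3) meets it in a geometric hyperplane: the tangent hyperplane at a point cuts
-- out the two lines through it, and each of the 24 hyperplanes whose normal vector lies off the
-- (self-dual) quadric cuts out an ovoid.  Conversely a geometric hyperplane meets each line in
-- one or all of its points, which leaves few enough candidates to check that these 40 sections
-- are all of them; so taking normal vectors identifies the geometric hyperplanes with the points
-- of PG(3,3).  In a Veldkamp line every point off the common core h₀ ∩ h₁ lies on exactly one
-- member, so three members determine the fourth.  Three hyperplanes with a common pairwise
-- intersection either have their normals on a line of PG(3,3), and then lie in a pencil (the
-- four hyperplanes through a line of PG(3,3)), or lie in one of six partitions of the points
-- into four ovoids; these are not pencils, as the normals of their members span more than a line.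
-- The finitely many facts this needs are established by evaluating decision procedures.

module Submission where

open import Defs
open import Data.Bool using (Bool; true; false; _∧_; _∨_; not)
open import Data.Bool.Properties using (¬-not; ∨-zeroʳ) renaming (_≟_ to _≟ᵇ_)
open import Data.Empty using (⊥; ⊥-elim)
open import Data.Fin using (Fin; zero; suc; #_; remQuot; punchOut; _<_)
open import Data.Fin.Properties using (∀-cons; pigeonhole; punchOut-injective; <⇒≢)
  renaming (_≟_ to _≟ᶠ_)
open import Data.Maybe using (Maybe; just; nothing)
import Data.Nat as ℕ
import Data.Nat.Properties as ℕ
open import Data.Product using (Σ; ∃; ∃₂; _×_; _,_; proj₁; proj₂; uncurry)
import Data.Product.Properties as Product
open import Data.Sum using (_⊎_; inj₁; inj₂; [_,_]; [_,_]′)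
import Data.Sum.Properties as Sum
open import Data.Vec using (Vec; []; _∷_; lookup; tabulate; map)
import Data.Vec.Properties as Vec
open import Function using (_∘_)
open import Function.Bundles using (_⇔_; mk⇔; Equivalence)
import Function.Properties.Equivalence as ⇔
open import Relation.Binary.Definitions using (DecidableEquality)
open import Relation.Binary.PropositionalEquality
  using (_≡_; _≢_; refl; sym; trans; cong; cong₂; subst; subst₂; module ≡-Reasoning)
open import Relation.Nullary using (Dec; yes; no; does; ¬_; contradiction)
open import Relation.Nullary.Decidable
  using (map′; ¬?; _×-dec_; _⊎-dec_; _→-dec_; from-yes)
open import Relation.Unary using (Decidable)

open Equivalence using (to; from)

infix 4 _≟₃_ _≟ᵛ_ _≟ˢ_ _≟ᵖ_ _≟⊎_

_≟₃_ : DecidableEquality F3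
𝟎 ≟₃ 𝟎 = yes refl
𝟎 ≟₃ 𝟏 = no λ ()
𝟎 ≟₃ 𝟐 = no λ ()
𝟏 ≟₃ 𝟎 = no λ ()
𝟏 ≟₃ 𝟏 = yes refl
𝟏 ≟₃ 𝟐 = no λ ()
𝟐 ≟₃ 𝟎 = no λ ()
𝟐 ≟₃ 𝟏 = no λ ()
𝟐 ≟₃ 𝟐 = yes refl

_≟ᵛ_ : DecidableEquality V4
_≟ᵛ_ = Vec.≡-dec _≟₃_

_≟ˢ_ : DecidableEquality Sub
_≟ˢ_ = Vec.≡-dec (Vec.≡-dec _≟ᵇ_)

_≟ᵖ_ : DecidableEquality Point
_≟ᵖ_ = Product.≡-dec _≟ᶠ_ _≟ᶠ_

_≟⊎_ : ∀ {m n} → DecidableEquality (Fin m ⊎ Fin n)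
_≟⊎_ = Sum.≡-dec _≟ᶠ_ _≟ᶠ_

infix 1 _⇔-dec_

_⇔-dec_ : {A B : Set} → Dec A → Dec B → Dec (A ⇔ B)
a? ⇔-dec b? = map′ (uncurry mk⇔) (λ a⇔b → to a⇔b , from a⇔b)
                   ((a? →-dec b?) ×-dec (b? →-dec a?))

∧-true⇔ : ∀ {x y} → x ∧ y ≡ true ⇔ (x ≡ true × y ≡ true)
∧-true⇔ {true}  = mk⇔ (refl ,_) proj₂
∧-true⇔ {false} = mk⇔ (λ ()) (λ ())

does-true⇔ : {A : Set} (a? : Dec A) → does a? ≡ true ⇔ A
does-true⇔ (yes a) = mk⇔ (λ _ → a) (λ _ → refl)
does-true⇔ (no ¬a) = mk⇔ (λ ()) (⊥-elim ∘ ¬a)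

Exhaustible Searchable : Set → Set₁
Exhaustible A = {P : A → Set} → Decidable P → Dec (∀ a → P a)
Searchable A = {P : A → Set} → Decidable P → Dec (∃ P)

every some : ∀ {n} → (Fin n → Bool) → Bool
every {ℕ.zero}  f = true
every {ℕ.suc n} f = f zero ∧ every (f ∘ suc)
some {ℕ.zero}  f = false
some {ℕ.suc n} f = f zero ∨ some (f ∘ suc)

every⇔ : ∀ {n} {f : Fin n → Bool} → every f ≡ true ⇔ (∀ i → f i ≡ true)
every⇔ {ℕ.zero}  = mk⇔ (λ _ ()) (λ _ → refl)
every⇔ {ℕ.suc n} = mk⇔ (λ all → let f₀ , rest = to ∧-true⇔ all in ∀-cons f₀ (to every⇔ rest))
                       (λ all → from ∧-true⇔ (all zero , from every⇔ (all ∘ suc)))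

some⇔ : ∀ {n} {f : Fin n → Bool} → some f ≡ true ⇔ (∃ λ i → f i ≡ true)
some⇔ {ℕ.zero}      = mk⇔ (λ ()) (λ ())
some⇔ {ℕ.suc n} {f} with f zero in f₀
... | true  = mk⇔ (λ _ → zero , f₀) (λ _ → refl)
... | false = mk⇔ (λ any → let i , fi = to some⇔ any in suc i , fi)
                  λ { (zero , f₀′) → contradiction (trans (sym f₀) f₀′) λ () ; (suc i , fi) → from some⇔ (i , fi) }

-- Unlike Data.Fin.Properties.all? and any?, these decide by a plain Boolean fold of
-- the individual tests, so that evaluating a large nested search does not retain
-- the proof components of all the decisions it has made.
all? : ∀ {n} → Exhaustible (Fin n)
all? P? = map′ (λ all i → to (does-true⇔ (P? i)) (to every⇔ all i))
               (λ all → from every⇔ λ i → from (does-true⇔ (P? i)) (all i))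
               (every (does ∘ P?) ≟ᵇ true)

any? : ∀ {n} → Searchable (Fin n)
any? P? = map′ (λ any → let i , t = to some⇔ any in i , to (does-true⇔ (P? i)) t)
               (λ (i , p) → from some⇔ (i , from (does-true⇔ (P? i)) p))
               (some (does ∘ P?) ≟ᵇ true)

allF3? : Exhaustible F3
allF3? P? = map′ (λ (p₀ , p₁ , p₂) → λ { 𝟎 → p₀ ; 𝟏 → p₁ ; 𝟐 → p₂ })
                 (λ p → p 𝟎 , p 𝟏 , p 𝟐) (P? 𝟎 ×-dec P? 𝟏 ×-dec P? 𝟐)

anyF3? : Searchable F3
anyF3? P? = map′ [ (𝟎 ,_) , [ (𝟏 ,_) , (𝟐 ,_) ] ]
                 (λ { (𝟎 , p) → inj₁ p ; (𝟏 , p) → inj₂ (inj₁ p) ; (𝟐 , p) → inj₂ (inj₂ p) })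
                 (P? 𝟎 ⊎-dec P? 𝟏 ⊎-dec P? 𝟐)

allVec? : ∀ {A n} → Exhaustible A → Exhaustible (Vec A n)
allVec? {n = ℕ.zero}  allA? P? = map′ (λ { p [] → p }) (λ p → p []) (P? [])
allVec? {n = ℕ.suc n} allA? P? = map′ (λ { p (a ∷ v) → p a v }) (λ p a v → p (a ∷ v))
                                      (allA? λ a → allVec? allA? λ v → P? (a ∷ v))

allV4? : Exhaustible V4
allV4? = allVec? allF3?

allMaybe? : ∀ {n} → Exhaustible (Maybe (Fin n))
allMaybe? P? = map′ (λ (p , q) → λ { nothing → p ; (just i) → q i })
                    (λ p → p nothing , p ∘ just) (P? nothing ×-dec all? (P? ∘ just))

allPoint? : Exhaustible Point
allPoint? P? = map′ (λ p q → p (proj₁ q) (proj₂ q)) (λ p a b → p (a , b))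
                    (all? λ a → all? λ b → P? (a , b))

anyPoint? : Searchable Point
anyPoint? P? = map′ (λ (a , b , p) → (a , b) , p) (λ ((a , b) , p) → a , b , p)
                    (any? λ a → any? λ b → P? (a , b))

allLine? : Exhaustible Line
allLine? P? = map′ (λ (p , q) → λ { (firstVaries b) → p b ; (secondVaries a) → q a })
                   (λ p → p ∘ firstVaries , p ∘ secondVaries)
                   (all? (P? ∘ firstVaries) ×-dec all? (P? ∘ secondVaries))

anyLine? : Searchable Line
anyLine? P? = map′ [ (λ (b , p) → firstVaries b , p) , (λ (a , p) → secondVaries a , p) ]
                   (λ { (firstVaries b , p) → inj₁ (b , p) ; (secondVaries a , p) → inj₂ (a , p) })
                   (any? (P? ∘ firstVaries) ⊎-dec any? (P? ∘ secondVaries))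

all⊎? : ∀ {m n} → Exhaustible (Fin m ⊎ Fin n)
all⊎? P? = map′ (λ (p , q) → [ p , q ]) (λ p → p ∘ inj₁ , p ∘ inj₂)
                (all? (P? ∘ inj₁) ×-dec all? (P? ∘ inj₂))

any⊎? : ∀ {m n} → Searchable (Fin m ⊎ Fin n)
any⊎? P? = map′ [ (λ (i , p) → inj₁ i , p) , (λ (j , p) → inj₂ j , p) ]
                (λ { (inj₁ i , p) → inj₁ (i , p) ; (inj₂ j , p) → inj₂ (j , p) })
                (any? (P? ∘ inj₁) ⊎-dec any? (P? ∘ inj₂))

onLine? : ∀ p L → Dec (OnLine p L)
onLine? p (firstVaries b)  = proj₂ p ≟ᶠ b
onLine? p (secondVaries a) = proj₁ p ≟ᶠ a

collinear? : ∀ p q → Dec (Collinear p q)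
collinear? p q = anyLine? λ L → onLine? p L ×-dec onLine? q L

independent? : ∀ u w → Dec (Independent u w)
independent? u w = allF3? λ α → allF3? λ β → (α · u) ⊕ (β · w) ≟ᵛ zero4 →-dec (α ≟₃ 𝟎 ×-dec β ≟₃ 𝟎)

proportional? : ∀ v w → Dec (Proportional v w)
proportional? v w = anyF3? λ α → ¬? (α ≟₃ 𝟎) ×-dec v ≟ᵛ (α · w)

allBool? : Exhaustible Bool
allBool? P? = map′ (λ (p , q) → λ { true → p ; false → q }) (λ p → p true , p false)
                   (P? true ×-dec P? false)

-- Walks through the vector, where `any? λ i → Q? (lookup xs i)` would redo a lookup per index.
anyEntry? : ∀ {A : Set} {Q : A → Set} → Decidable Q → ∀ {n} (xs : Vec A n) → Dec (∃ λ i → Q (lookup xs i))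
anyEntry? Q? []       = no λ ()
anyEntry? Q? (x ∷ xs) = map′ [ (zero ,_) , (λ (i , q) → suc i , q) ]
                             (λ { (zero , q) → inj₁ q ; (suc i , q) → inj₂ (i , q) })
                             (Q? x ⊎-dec anyEntry? Q? xs)

_∈ᵇ_ : Point → Sub → Bool
(a , b) ∈ᵇ H = lookup (lookup H a) b

infix 4 _∈?_

_∈?_ : ∀ p H → Dec (p ∈ₛ H)
p ∈? H = p ∈ᵇ H ≟ᵇ true

setOf : (Point → Bool) → Sub
setOf f = tabulate λ a → tabulate λ b → f (a , b)

∈ᵇ-setOf : ∀ f p → p ∈ᵇ setOf f ≡ f p
∈ᵇ-setOf f (a , b) =
  trans (cong (λ row → lookup row b) (Vec.lookup∘tabulate (λ a′ → tabulate λ b′ → f (a′ , b′)) a))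
        (Vec.lookup∘tabulate (λ b′ → f (a , b′)) b)

setOf-∈ᵇ : ∀ H → setOf (_∈ᵇ H) ≡ H
setOf-∈ᵇ H = trans (Vec.tabulate-cong λ a → Vec.tabulate∘lookup (lookup H a)) (Vec.tabulate∘lookup H)

∈ᵇ-injective : ∀ {A B} → (∀ p → p ∈ᵇ A ≡ p ∈ᵇ B) → A ≡ B
∈ᵇ-injective {A} {B} A≗B = trans (sym (setOf-∈ᵇ A)) (trans setOf-cong (setOf-∈ᵇ B))
  where
  setOf-cong : setOf (_∈ᵇ A) ≡ setOf (_∈ᵇ B)
  setOf-cong = Vec.tabulate-cong λ a → Vec.tabulate-cong λ b → A≗B (a , b)

⇔-true⇒≡ : ∀ {x y} → (x ≡ true ⇔ y ≡ true) → x ≡ y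
⇔-true⇒≡ {true}  {true}  _ = refl
⇔-true⇒≡ {false} {false} _ = refl
⇔-true⇒≡ {true}  {false} x⇔y = sym (to x⇔y refl)
⇔-true⇒≡ {false} {true}  x⇔y = from x⇔y refl

∈ₛ-injective : ∀ {A B} → (∀ p → p ∈ₛ A ⇔ p ∈ₛ B) → A ≡ B
∈ₛ-injective A⇔B = ∈ᵇ-injective (⇔-true⇒≡ ∘ A⇔B)

infixl 25 _∩ˢ_

_∩ˢ_ : Sub → Sub → Sub
A ∩ˢ B = setOf λ p → p ∈ᵇ A ∧ p ∈ᵇ B

∈ᵇ-∩ˢ : ∀ A B p → p ∈ᵇ A ∩ˢ B ≡ p ∈ᵇ A ∧ p ∈ᵇ B
∈ᵇ-∩ˢ A B = ∈ᵇ-setOf (λ q → q ∈ᵇ A ∧ q ∈ᵇ B)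

∈ₛ-∩ˢ : ∀ A B p → p ∈ₛ A ∩ˢ B ⇔ (p ∈ₛ A × p ∈ₛ B)
∈ₛ-∩ˢ A B p rewrite ∈ᵇ-∩ˢ A B p = ∧-true⇔

∩ˢ-⇔ : ∀ {A B C D} → A ∩ˢ B ≡ C ∩ˢ D → ∀ p → (p ∈ₛ A × p ∈ₛ B) ⇔ (p ∈ₛ C × p ∈ₛ D)
∩ˢ-⇔ {A} {B} {C} {D} eq p = ⇔.trans (⇔.sym (∈ₛ-∩ˢ A B p))
  (subst (λ X → p ∈ₛ X ⇔ (p ∈ₛ C × p ∈ₛ D)) (sym eq) (∈ₛ-∩ˢ C D p))

⇔-∩ˢ : ∀ {A B C D} → (∀ p → (p ∈ₛ A × p ∈ₛ B) ⇔ (p ∈ₛ C × p ∈ₛ D)) → A ∩ˢ B ≡ C ∩ˢ D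
⇔-∩ˢ {A} {B} {C} {D} meets = ∈ₛ-injective λ p →
  ⇔.trans (∈ₛ-∩ˢ A B p) (⇔.trans (meets p) (⇔.sym (∈ₛ-∩ˢ C D p)))

_∈⟨_,_⟩ : V4 → V4 → V4 → Set
v ∈⟨ u , w ⟩ = Σ F3 λ α → Σ F3 λ β → v ≡ (α · u) ⊕ (β · w)

_∈⟨_,_⟩? : ∀ v u w → Dec (v ∈⟨ u , w ⟩)
v ∈⟨ u , w ⟩? = anyF3? λ α → anyF3? λ β → v ≟ᵛ (α · u) ⊕ (β · w)

-- Facts established by evaluating a decision procedure are kept opaque: otherwise later
-- type checking may unfold them and run the whole evaluation again.
opaque
  solvable-or-dependent : ∀ α₀ β₀ α₁ β₁ α₂ β₂ →
    (Σ F3 λ γ → Σ F3 λ δ → (γ *₃ α₀) +₃ (δ *₃ α₁) ≡ α₂ × (γ *₃ β₀) +₃ (δ *₃ β₁) ≡ β₂) ⊎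
    (Σ F3 λ λ₀ → Σ F3 λ λ₁ → ¬ (λ₀ ≡ 𝟎 × λ₁ ≡ 𝟎) ×
                              (λ₀ *₃ α₀) +₃ (λ₁ *₃ α₁) ≡ 𝟎 × (λ₀ *₃ β₀) +₃ (λ₁ *₃ β₁) ≡ 𝟎)
  solvable-or-dependent = from-yes (allF3? λ α₀ → allF3? λ β₀ → allF3? λ α₁ → allF3? λ β₁ →
    allF3? λ α₂ → allF3? λ β₂ →
    (anyF3? λ γ → anyF3? λ δ → (γ *₃ α₀) +₃ (δ *₃ α₁) ≟₃ α₂ ×-dec (γ *₃ β₀) +₃ (δ *₃ β₁) ≟₃ β₂) ⊎-dec
    (anyF3? λ λ₀ → anyF3? λ λ₁ → ¬? (λ₀ ≟₃ 𝟎 ×-dec λ₁ ≟₃ 𝟎) ×-dec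
                                 (λ₀ *₃ α₀) +₃ (λ₁ *₃ α₁) ≟₃ 𝟎 ×-dec (λ₀ *₃ β₀) +₃ (λ₁ *₃ β₁) ≟₃ 𝟎))

  combination-coefficients : ∀ γ δ α₀ β₀ α₁ β₁ x y →
    (γ *₃ ((α₀ *₃ x) +₃ (β₀ *₃ y))) +₃ (δ *₃ ((α₁ *₃ x) +₃ (β₁ *₃ y))) ≡
    (((γ *₃ α₀) +₃ (δ *₃ α₁)) *₃ x) +₃ (((γ *₃ β₀) +₃ (δ *₃ β₁)) *₃ y)
  combination-coefficients = from-yes (allF3? λ γ → allF3? λ δ → allF3? λ α₀ → allF3? λ β₀ →
    allF3? λ α₁ → allF3? λ β₁ → allF3? λ x → allF3? λ y →
    (γ *₃ ((α₀ *₃ x) +₃ (β₀ *₃ y))) +₃ (δ *₃ ((α₁ *₃ x) +₃ (β₁ *₃ y))) ≟₃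
    (((γ *₃ α₀) +₃ (δ *₃ α₁)) *₃ x) +₃ (((γ *₃ β₀) +₃ (δ *₃ β₁)) *₃ y))

combination-of-combinations : ∀ γ δ α₀ β₀ α₁ β₁ u w →
  (γ · ((α₀ · u) ⊕ (β₀ · w))) ⊕ (δ · ((α₁ · u) ⊕ (β₁ · w))) ≡
  (((γ *₃ α₀) +₃ (δ *₃ α₁)) · u) ⊕ (((γ *₃ β₀) +₃ (δ *₃ β₁)) · w)
combination-of-combinations γ δ α₀ β₀ α₁ β₁ (u₀ ∷ u₁ ∷ u₂ ∷ u₃ ∷ []) (w₀ ∷ w₁ ∷ w₂ ∷ w₃ ∷ []) =
  cong₂ _∷_ (c u₀ w₀) (cong₂ _∷_ (c u₁ w₁) (cong₂ _∷_ (c u₂ w₂) (cong₂ _∷_ (c u₃ w₃) refl)))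
  where
  c : ∀ x y → (γ *₃ ((α₀ *₃ x) +₃ (β₀ *₃ y))) +₃ (δ *₃ ((α₁ *₃ x) +₃ (β₁ *₃ y))) ≡
              (((γ *₃ α₀) +₃ (δ *₃ α₁)) *₃ x) +₃ (((γ *₃ β₀) +₃ (δ *₃ β₁)) *₃ y)
  c = combination-coefficients γ δ α₀ β₀ α₁ β₁

zero-combination : ∀ u w → (𝟎 · u) ⊕ (𝟎 · w) ≡ zero4
zero-combination (_ ∷ _ ∷ _ ∷ _ ∷ []) (_ ∷ _ ∷ _ ∷ _ ∷ []) = refl

span-exchange : ∀ {u w a b c} → Independent a b →
                a ∈⟨ u , w ⟩ → b ∈⟨ u , w ⟩ → c ∈⟨ u , w ⟩ → c ∈⟨ a , b ⟩
span-exchange {u} {w} independent (α₀ , β₀ , refl) (α₁ , β₁ , refl) (α₂ , β₂ , refl)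
  with solvable-or-dependent α₀ β₀ α₁ β₁ α₂ β₂
... | inj₁ (γ , δ , eα , eβ) = γ , δ , (begin
  (α₂ · u) ⊕ (β₂ · w)
    ≡⟨ cong₂ (λ α β → (α · u) ⊕ (β · w)) (sym eα) (sym eβ) ⟩
  (((γ *₃ α₀) +₃ (δ *₃ α₁)) · u) ⊕ (((γ *₃ β₀) +₃ (δ *₃ β₁)) · w)
    ≡⟨ sym (combination-of-combinations γ δ α₀ β₀ α₁ β₁ u w) ⟩
  (γ · ((α₀ · u) ⊕ (β₀ · w))) ⊕ (δ · ((α₁ · u) ⊕ (β₁ · w)))
    ∎)
  where open ≡-Reasoning
... | inj₂ (λ₀ , λ₁ , nonzero , eα , eβ) = contradiction (independent λ₀ λ₁ dependency) nonzero
  where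
  open ≡-Reasoning
  dependency : (λ₀ · ((α₀ · u) ⊕ (β₀ · w))) ⊕ (λ₁ · ((α₁ · u) ⊕ (β₁ · w))) ≡ zero4
  dependency = begin
    (λ₀ · ((α₀ · u) ⊕ (β₀ · w))) ⊕ (λ₁ · ((α₁ · u) ⊕ (β₁ · w)))
      ≡⟨ combination-of-combinations λ₀ λ₁ α₀ β₀ α₁ β₁ u w ⟩
    (((λ₀ *₃ α₀) +₃ (λ₁ *₃ α₁)) · u) ⊕ (((λ₀ *₃ β₀) +₃ (λ₁ *₃ β₁)) · w)
      ≡⟨ cong₂ (λ α β → (α · u) ⊕ (β · w)) eα eβ ⟩
    (𝟎 · u) ⊕ (𝟎 · w)
      ≡⟨ zero-combination u w ⟩
    zero4
      ∎

opaque
  dot-scale : ∀ α c v → dot (α · c) v ≡ α *₃ dot c v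
  dot-scale = from-yes (allF3? λ α → allV4? λ c → allV4? λ v → dot (α · c) v ≟₃ α *₃ dot c v)

*₃-zeroʳ : ∀ α → α *₃ 𝟎 ≡ 𝟎
*₃-zeroʳ 𝟎 = refl
*₃-zeroʳ 𝟏 = refl
*₃-zeroʳ 𝟐 = refl

section : V4 → Sub
section c = setOf λ p → does (dot c (seg p) ≟₃ 𝟎)

∈ₛ-section : ∀ c p → p ∈ₛ section c ⇔ dot c (seg p) ≡ 𝟎
∈ₛ-section c p rewrite ∈ᵇ-setOf (λ q → does (dot c (seg q) ≟₃ 𝟎)) p = does-true⇔ (dot c (seg p) ≟₃ 𝟎)

section-isProjective : ∀ c → c ≢ zero4 → IsProjectiveHyperplane (section c)
section-isProjective c c≢0 = c , c≢0 , ∈ₛ-section c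

-- The image of seg is the quadric x₀x₃ = x₁x₂; polar is its polarity, so
-- polar (seg p) is the normal of the tangent hyperplane at seg p.
polar : V4 → V4
polar (x₀ ∷ x₁ ∷ x₂ ∷ x₃ ∷ []) = x₃ ∷ 𝟐 *₃ x₂ ∷ 𝟐 *₃ x₁ ∷ x₀ ∷ []

point : Fin 16 → Point
point = remQuot 4

-- The 24 points of PG(3,3) off the quadric x₀x₃ = x₁x₂, normalised.
offQuadric : Fin 24 → V4
offQuadric = lookup
  ( v 𝟎 𝟏 𝟏 𝟎 ∷ v 𝟎 𝟏 𝟏 𝟏 ∷ v 𝟎 𝟏 𝟏 𝟐 ∷ v 𝟎 𝟏 𝟐 𝟎 ∷ v 𝟎 𝟏 𝟐 𝟏 ∷ v 𝟎 𝟏 𝟐 𝟐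
  ∷ v 𝟏 𝟎 𝟎 𝟏 ∷ v 𝟏 𝟎 𝟎 𝟐 ∷ v 𝟏 𝟎 𝟏 𝟏 ∷ v 𝟏 𝟎 𝟏 𝟐 ∷ v 𝟏 𝟎 𝟐 𝟏 ∷ v 𝟏 𝟎 𝟐 𝟐
  ∷ v 𝟏 𝟏 𝟎 𝟏 ∷ v 𝟏 𝟏 𝟎 𝟐 ∷ v 𝟏 𝟏 𝟏 𝟎 ∷ v 𝟏 𝟏 𝟏 𝟐 ∷ v 𝟏 𝟏 𝟐 𝟎 ∷ v 𝟏 𝟏 𝟐 𝟏
  ∷ v 𝟏 𝟐 𝟎 𝟏 ∷ v 𝟏 𝟐 𝟎 𝟐 ∷ v 𝟏 𝟐 𝟏 𝟎 ∷ v 𝟏 𝟐 𝟏 𝟏 ∷ v 𝟏 𝟐 𝟐 𝟎 ∷ v 𝟏 𝟐 𝟐 𝟐 ∷ [])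
  where
  v : F3 → F3 → F3 → F3 → V4
  v x₀ x₁ x₂ x₃ = x₀ ∷ x₁ ∷ x₂ ∷ x₃ ∷ []

Hyp : Set
Hyp = Fin 16 ⊎ Fin 24

normal : Hyp → V4
normal = [ polar ∘ seg ∘ point , offQuadric ]

hyperplane : Hyp → Sub
hyperplane x = section (normal x)

isGeomHyperplane? : ∀ H → Dec (IsGeomHyperplane H)
isGeomHyperplane? H = anyPoint? (λ p → ¬? (p ∈? H)) ×-dec allLine? λ L →
  allPoint? (λ q → onLine? q L →-dec q ∈? H) ⊎-dec
  anyPoint? λ p → onLine? p L ×-dec p ∈? H ×-dec
                  allPoint? λ q → onLine? q L →-dec q ∈? H →-dec q ≟ᵖ p

opaque
  normal≢0 : ∀ x → normal x ≢ zero4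
  normal≢0 = from-yes (all⊎? λ x → ¬? (normal x ≟ᵛ zero4))

  normal-surjective : ∀ v → v ≢ zero4 → ∃ λ x → Proportional (normal x) v
  normal-surjective = from-yes (allV4? λ v → ¬? (v ≟ᵛ zero4) →-dec any⊎? λ x → proportional? (normal x) v)

  normal-proportional⇒≡ : ∀ x y → Proportional (normal x) (normal y) → x ≡ y
  normal-proportional⇒≡ = from-yes (all⊎? λ x → all⊎? λ y →
    proportional? (normal x) (normal y) →-dec x ≟⊎ y)

  normal-independent : ∀ a b → a ≢ b → Independent (normal a) (normal b)
  normal-independent = from-yes (all⊎? λ a → all⊎? λ b → ¬? (a ≟⊎ b) →-dec independent? (normal a) (normal b))

  hyperplane-injective : ∀ x y → hyperplane x ≡ hyperplane y → x ≡ y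
  hyperplane-injective = from-yes (all⊎? λ x → all⊎? λ y → hyperplane x ≟ˢ hyperplane y →-dec x ≟⊎ y)

  section-determines-normal : ∀ c x → section c ≡ hyperplane x → Proportional (normal x) c
  section-determines-normal = from-yes (allV4? λ c → all⊎? λ x →
    section c ≟ˢ hyperplane x →-dec proportional? (normal x) c)

  hyperplane-isGeomHyperplane : ∀ x → IsGeomHyperplane (hyperplane x)
  hyperplane-isGeomHyperplane = from-yes (all⊎? λ x → isGeomHyperplane? (hyperplane x))

section-annihilator : ∀ {c x u} → section c ≡ hyperplane x → dot c u ≡ 𝟎 → dot (normal x) u ≡ 𝟎
section-annihilator {c} {x} {u} c≡x cu≡0 with section-determines-normal c x c≡x
... | α , _ , x≡αc = begin
  dot (normal x) u  ≡⟨ cong (λ n → dot n u) x≡αc ⟩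
  dot (α · c) u     ≡⟨ dot-scale α c u ⟩
  α *₃ dot c u      ≡⟨ cong (α *₃_) cu≡0 ⟩
  α *₃ 𝟎            ≡⟨ *₃-zeroʳ α ⟩
  𝟎                 ∎
  where open ≡-Reasoning

tangent-isSingular : ∀ i → IsSingular (hyperplane (inj₁ i))
tangent-isSingular i = point i , on-tangent⇔collinear i
  where
  on-tangent⇔collinear : ∀ i q → q ∈ₛ hyperplane (inj₁ i) ⇔ Collinear (point i) q
  on-tangent⇔collinear = from-yes (all? λ i → allPoint? λ q →
    q ∈? hyperplane (inj₁ i) ⇔-dec collinear? (point i) q)

ovoid-criterion : ∀ H → (∀ a → ∃ λ b → (a , b) ∈ₛ H) →
                  (∀ p q → p ∈ₛ H → q ∈ₛ H → Collinear p q → p ≡ q) → IsOvoid H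
ovoid-criterion H meets-row no-two-collinear =
  (e , (λ _ _ → cong proj₁) , λ q → mk⇔ (∈⇒listed q) (listed⇒∈ q)) , noncollinear
  where
  e : Fin 4 → Point
  e a = a , proj₁ (meets-row a)
  ∈⇒listed : ∀ q → q ∈ₛ H → Σ (Fin 4) λ a → e a ≡ q
  ∈⇒listed (a , b) q∈H =
    a , no-two-collinear (e a) (a , b) (proj₂ (meets-row a)) q∈H (secondVaries a , refl , refl)
  listed⇒∈ : ∀ q → (Σ (Fin 4) λ a → e a ≡ q) → q ∈ₛ H
  listed⇒∈ q (a , refl) = proj₂ (meets-row a)
  noncollinear : ∀ p q → p ∈ₛ H → q ∈ₛ H → p ≢ q → ¬ Collinear p q
  noncollinear p q p∈H q∈H p≢q = p≢q ∘ no-two-collinear p q p∈H q∈H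

offQuadric-isOvoid : ∀ j → IsOvoid (hyperplane (inj₂ j))
offQuadric-isOvoid j = ovoid-criterion (hyperplane (inj₂ j)) (meets-row j) (no-two-collinear j)
  where
  meets-row : ∀ j a → ∃ λ b → (a , b) ∈ₛ hyperplane (inj₂ j)
  meets-row = from-yes (all? λ j → all? λ a → any? λ b → (a , b) ∈? hyperplane (inj₂ j))
  no-two-collinear : ∀ j p q → p ∈ₛ hyperplane (inj₂ j) → q ∈ₛ hyperplane (inj₂ j) → Collinear p q → p ≡ q
  no-two-collinear = from-yes (all? λ j → allPoint? λ p → allPoint? λ q →
    p ∈? hyperplane (inj₂ j) →-dec q ∈? hyperplane (inj₂ j) →-dec collinear? p q →-dec p ≟ᵖ q)

-- A line meets a geometric hyperplane in all of its points (nothing) or in exactly one (just b).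
rowPattern : Maybe PG1 → Vec Bool 4
rowPattern nothing  = tabulate λ _ → true
rowPattern (just b) = tabulate λ b′ → does (b ≟ᶠ b′)

≡-tabulate : ∀ {A : Set} {n} {xs : Vec A n} {f} → (∀ i → lookup xs i ≡ f i) → xs ≡ tabulate f
≡-tabulate {xs = xs} eq = trans (sym (Vec.tabulate∘lookup xs)) (Vec.tabulate-cong eq)

geomHyperplane-row : ∀ {H} → IsGeomHyperplane H → ∀ a → ∃ λ m → lookup H a ≡ rowPattern m
geomHyperplane-row {H} (_ , meets) a with meets (secondVaries a)
... | inj₁ row⊆H = nothing , ≡-tabulate λ b → row⊆H (a , b) refl
... | inj₂ ((_ , b) , refl , p∈H , unique) = just b , ≡-tabulate pattern-at
  where
  pattern-at : ∀ b′ → (a , b′) ∈ᵇ H ≡ does (b ≟ᶠ b′)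
  pattern-at b′ with b ≟ᶠ b′
  ... | yes refl = p∈H
  ... | no b≢b′ = ¬-not λ q∈H → b≢b′ (sym (cong proj₂ (unique (a , b′) refl q∈H)))

geomHyperplane-rows : ∀ {H} → IsGeomHyperplane H → ∃ λ ms → H ≡ map rowPattern ms
geomHyperplane-rows {H} geom =
  tabulate m , trans (≡-tabulate (proj₂ ∘ geomHyperplane-row {H} geom)) (Vec.tabulate-∘ rowPattern m)
  where
  m : Fin 4 → Maybe PG1
  m = proj₁ ∘ geomHyperplane-row {H} geom

-- The 5⁴ candidates allowed by the rows are checked one by one.
opaque
  rowPatterns-classified : ∀ ms → IsGeomHyperplane (map rowPattern ms) →
                           ∃ λ x → hyperplane x ≡ map rowPattern ms
  rowPatterns-classified = from-yes (allVec? allMaybe? λ ms →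
    isGeomHyperplane? (map rowPattern ms) →-dec any⊎? λ x → hyperplane x ≟ˢ map rowPattern ms)

geomHyperplane-classification : ∀ {H} → IsGeomHyperplane H → ∃ λ x → hyperplane x ≡ H
geomHyperplane-classification {H} geom =
  let ms , H≡rows = geomHyperplane-rows {H} geom
      x , x≡rows = rowPatterns-classified ms (subst IsGeomHyperplane H≡rows geom)
  in x , trans x≡rows (sym H≡rows)

Distinct : ∀ {A : Set} {n} → (Fin n → A) → Set
Distinct h = ∀ i j → i ≢ j → h i ≢ h j

distinct? : ∀ {A : Set} {n} → DecidableEquality A → (f : Fin n → A) → Dec (Distinct f)
distinct? _≟_ f = all? λ i → all? λ j → ¬? (i ≟ᶠ j) →-dec ¬? (f i ≟ f j)

distinct⇒injective : ∀ {A : Set} {n} {f : Fin n → A} → Distinct f → ∀ {i j} → f i ≡ f j → i ≡ j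
distinct⇒injective {f = f} f-distinct {i} {j} fi≡fj with i ≟ᶠ j
... | yes i≡j = i≡j
... | no i≢j  = ⊥-elim (f-distinct i j i≢j fi≡fj)

injective⇒surjective : ∀ {n} (f : Fin n → Fin n) → (∀ {i j} → f i ≡ f j → i ≡ j) →
                       ∀ k → ∃ λ i → f i ≡ k
injective⇒surjective {ℕ.suc n} f f-injective k with any? (λ i → f i ≟ᶠ k)
... | yes hit = hit
... | no miss = ⊥-elim (collision (pigeonhole ℕ.≤-refl λ i → punchOut (k≢f i)))
  where
  k≢f : ∀ i → k ≢ f i
  k≢f i k≡fi = miss (i , sym k≡fi)
  collision : (∃₂ λ i j → i < j × punchOut (k≢f i) ≡ punchOut (k≢f j)) → ⊥
  collision (i , j , i<j , eq) = <⇒≢ i<j (f-injective (punchOut-injective (k≢f i) (k≢f j) eq))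

module _ {g h : Fin 4 → Sub} (π : Fin 4 → Fin 4) (h≗gπ : ∀ i → h i ≡ g (π i)) where

  relabel-Distinct : Distinct h → Distinct π
  relabel-Distinct h-distinct i j i≢j πi≡πj =
    h-distinct i j i≢j (trans (h≗gπ i) (trans (cong g πi≡πj) (sym (h≗gπ j))))

  relabel-SameSet : Distinct π → SameSet h g
  relabel-SameSet π-distinct = (λ i → π i , h≗gπ i) , λ j →
    let i , πi≡j = injective⇒surjective π (distinct⇒injective π-distinct) j
    in i , trans (cong g (sym πi≡j)) (sym (h≗gπ i))

  relabel-isVeldkampLine : Distinct h → IsVeldkampLine g → IsVeldkampLine h
  relabel-isVeldkampLine h-distinct (g-geom , _ , g-meets , g-cover) =
    (λ i → subst IsGeomHyperplane (sym (h≗gπ i)) (g-geom (π i))) , h-distinct , meets , cover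
    where
    π-distinct : Distinct π
    π-distinct = relabel-Distinct h-distinct
    meets : ∀ i j k l → i ≢ j → k ≢ l → ∀ p → (p ∈ₛ h i × p ∈ₛ h j) ⇔ (p ∈ₛ h k × p ∈ₛ h l)
    meets i j k l i≢j k≢l p rewrite h≗gπ i | h≗gπ j | h≗gπ k | h≗gπ l =
      g-meets (π i) (π j) (π k) (π l) (π-distinct i j i≢j) (π-distinct k l k≢l) p
    cover : ∀ p → ∃ λ i → p ∈ₛ h i
    cover p with g-cover p
    ... | m , p∈gm with injective⇒surjective π (distinct⇒injective π-distinct) m
    ...   | i , refl = i , subst (p ∈ₛ_) (sym (h≗gπ i)) p∈gm

  relabel-isProjectiveVeldkampLine : IsProjectiveVeldkampLine g → IsProjectiveVeldkampLine h
  relabel-isProjectiveVeldkampLine (u , w , u⊥w , f , f-spec) = u , w , u⊥w , f ∘ π , spec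
    where
    spec : ∀ i → f (π i) ≢ zero4 × dot (f (π i)) u ≡ 𝟎 × dot (f (π i)) w ≡ 𝟎 ×
                 (∀ p → p ∈ₛ h i ⇔ dot (f (π i)) (seg p) ≡ 𝟎)
    spec i rewrite h≗gπ i = f-spec (π i)

hyperplane-indices : ∀ {h} → (∀ i → IsGeomHyperplane (h i)) → Distinct h →
                     ∃ λ x → Distinct x × ∀ i → h i ≡ hyperplane (x i)
hyperplane-indices {h} geom h-distinct = x , x-distinct , h≡x
  where
  x : Fin 4 → Hyp
  x i = proj₁ (geomHyperplane-classification (geom i))
  h≡x : ∀ i → h i ≡ hyperplane (x i)
  h≡x i = sym (proj₂ (geomHyperplane-classification (geom i)))
  x-distinct : Distinct x
  x-distinct i j i≢j xi≡xj =
    h-distinct i j i≢j (trans (h≡x i) (trans (cong hyperplane xi≡xj) (sym (h≡x j))))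

veldkamp-∩ˢ : ∀ {h} → IsVeldkampLine h → ∀ {i j k l} → i ≢ j → k ≢ l → h i ∩ˢ h j ≡ h k ∩ˢ h l
veldkamp-∩ˢ {h} (_ , _ , meets , _) {i} {j} {k} {l} i≢j k≢l =
  ⇔-∩ˢ {h i} {h j} {h k} {h l} (meets i j k l i≢j k≢l)

∩ˢ-isVeldkampLine : ∀ {h} → (∀ i → IsGeomHyperplane (h i)) → Distinct h →
  (∀ i j → i ≢ j → h i ∩ˢ h j ≡ h zero ∩ˢ h (suc zero)) → (∀ p → ∃ λ i → p ∈ₛ h i) →
  IsVeldkampLine h
∩ˢ-isVeldkampLine {h} geom distinct core cover = geom , distinct , meets , cover
  where
  meets : ∀ i j k l → i ≢ j → k ≢ l → ∀ p → (p ∈ₛ h i × p ∈ₛ h j) ⇔ (p ∈ₛ h k × p ∈ₛ h l)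
  meets i j k l i≢j k≢l = ∩ˢ-⇔ {h i} {h j} {h k} {h l} (trans (core i j i≢j) (sym (core k l k≢l)))

-- A point lies on h₃ iff it lies on the common core h₀ ∩ h₁, or on none of h₀, h₁, h₂.
fourthᵇ : Bool → Bool → Bool → Bool
fourthᵇ a b c = (a ∧ b) ∨ not (a ∨ b ∨ c)

fourth : Sub → Sub → Sub → Sub
fourth A B C = setOf λ p → fourthᵇ (p ∈ᵇ A) (p ∈ᵇ B) (p ∈ᵇ C)

opaque
  fourth-truthTable : ∀ a b c d → a ∧ b ≡ c ∧ d → a ∧ c ≡ b ∧ d → a ∧ d ≡ b ∧ c →
                      a ∨ b ∨ c ∨ d ≡ true → d ≡ fourthᵇ a b c
  fourth-truthTable = from-yes (allBool? λ a → allBool? λ b → allBool? λ c → allBool? λ d →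
    a ∧ b ≟ᵇ c ∧ d →-dec a ∧ c ≟ᵇ b ∧ d →-dec a ∧ d ≟ᵇ b ∧ c →-dec
    a ∨ b ∨ c ∨ d ≟ᵇ true →-dec d ≟ᵇ fourthᵇ a b c)

∨-true : ∀ (x : Fin 4 → Bool) i → x i ≡ true → x (# 0) ∨ x (# 1) ∨ x (# 2) ∨ x (# 3) ≡ true
∨-true x zero                   xi≡true rewrite xi≡true = refl
∨-true x (suc zero)             xi≡true rewrite xi≡true = ∨-zeroʳ (x (# 0))
∨-true x (suc (suc zero))       xi≡true rewrite xi≡true | ∨-zeroʳ (x (# 1)) = ∨-zeroʳ (x (# 0))
∨-true x (suc (suc (suc zero))) xi≡true rewrite xi≡true | ∨-zeroʳ (x (# 2)) | ∨-zeroʳ (x (# 1)) =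
  ∨-zeroʳ (x (# 0))

veldkamp-fourth : ∀ {h} → IsVeldkampLine h → h (# 3) ≡ fourth (h (# 0)) (h (# 1)) (h (# 2))
veldkamp-fourth {h} V@(_ , _ , _ , cover) = ∈ᵇ-injective λ p →
  let i , p∈hi = cover p in
  trans (fourth-truthTable (p ∈ᵇ h (# 0)) (p ∈ᵇ h (# 1)) (p ∈ᵇ h (# 2)) (p ∈ᵇ h (# 3))
           (core p (λ ()) (λ ())) (core p (λ ()) (λ ())) (core p (λ ()) (λ ()))
           (∨-true (λ i → p ∈ᵇ h i) i p∈hi))
        (sym (∈ᵇ-setOf (λ q → fourthᵇ (q ∈ᵇ h (# 0)) (q ∈ᵇ h (# 1)) (q ∈ᵇ h (# 2))) p))
  where
  core : ∀ p {i j k l} → i ≢ j → k ≢ l → p ∈ᵇ h i ∧ p ∈ᵇ h j ≡ p ∈ᵇ h k ∧ p ∈ᵇ h l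
  core p {i} {j} {k} {l} i≢j k≢l = trans (sym (∈ᵇ-∩ˢ (h i) (h j) p))
    (trans (cong (p ∈ᵇ_) (veldkamp-∩ˢ V i≢j k≢l)) (∈ᵇ-∩ˢ (h k) (h l) p))

veldkamp-determinedByThree : ∀ {g h} → IsVeldkampLine g → IsVeldkampLine h →
  g (# 0) ≡ h (# 0) → g (# 1) ≡ h (# 1) → g (# 2) ≡ h (# 2) → g (# 3) ≡ h (# 3)
veldkamp-determinedByThree {g} {h} Vg Vh eq₀ eq₁ eq₂ = begin
  g (# 3)                                ≡⟨ veldkamp-fourth Vg ⟩
  fourth (g (# 0)) (g (# 1)) (g (# 2))   ≡⟨ cong₃ fourth eq₀ eq₁ eq₂ ⟩
  fourth (h (# 0)) (h (# 1)) (h (# 2))   ≡⟨ sym (veldkamp-fourth Vh) ⟩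
  h (# 3)                                ∎
  where
  open ≡-Reasoning
  cong₃ : ∀ (f : Sub → Sub → Sub → Sub) {a a′ b b′ c c′} →
          a ≡ a′ → b ≡ b′ → c ≡ c′ → f a b c ≡ f a′ b′ c′
  cong₃ f refl refl refl = refl

opaque
  fourth-index : ∀ (j₀ j₁ j₂ : Fin 4) → j₀ ≢ j₁ → j₀ ≢ j₂ → j₁ ≢ j₂ →
                 ∃ λ j₃ → Distinct (lookup (j₀ ∷ j₁ ∷ j₂ ∷ j₃ ∷ []))
  fourth-index = from-yes (all? λ (j₀ : Fin 4) → all? λ j₁ → all? λ j₂ →
    ¬? (j₀ ≟ᶠ j₁) →-dec ¬? (j₀ ≟ᶠ j₂) →-dec ¬? (j₁ ≟ᶠ j₂) →-dec
    any? λ j₃ → distinct? _≟ᶠ_ (lookup (j₀ ∷ j₁ ∷ j₂ ∷ j₃ ∷ [])))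

veldkamp-shareThree : ∀ {g h} → IsVeldkampLine g → IsVeldkampLine h → ∀ {j₀ j₁ j₂} →
                      h (# 0) ≡ g j₀ → h (# 1) ≡ g j₁ → h (# 2) ≡ g j₂ → SameSet h g
veldkamp-shareThree {g} {h} Vg@(_ , g-distinct , _ , _) Vh@(_ , h-distinct , _ , _) {j₀} {j₁} {j₂} e₀ e₁ e₂ =
  relabelled (fourth-index j₀ j₁ j₂ (apart (# 0) (# 1) e₀ e₁ λ ()) (apart (# 0) (# 2) e₀ e₂ λ ())
                                    (apart (# 1) (# 2) e₁ e₂ λ ()))
  where
  apart : ∀ a b {i k} → h a ≡ g i → h b ≡ g k → a ≢ b → i ≢ k
  apart a b ea eb a≢b refl = h-distinct a b a≢b (trans ea (sym eb))
  relabelled : (∃ λ j₃ → Distinct (lookup (j₀ ∷ j₁ ∷ j₂ ∷ j₃ ∷ []))) → SameSet h g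
  relabelled (j₃ , π-distinct) = relabel-SameSet π h≡gπ π-distinct
    where
    π : Fin 4 → Fin 4
    π = lookup (j₀ ∷ j₁ ∷ j₂ ∷ j₃ ∷ [])
    gπ-isVeldkampLine : IsVeldkampLine (g ∘ π)
    gπ-isVeldkampLine = relabel-isVeldkampLine π (λ _ → refl)
      (λ i j i≢j → g-distinct (π i) (π j) (π-distinct i j i≢j)) Vg
    h≡gπ : ∀ i → h i ≡ g (π i)
    h≡gπ zero                   = e₀
    h≡gπ (suc zero)             = e₁
    h≡gπ (suc (suc zero))       = e₂
    h≡gπ (suc (suc (suc zero))) = veldkamp-determinedByThree Vh gπ-isVeldkampLine e₀ e₁ e₂

record Pencil : Set where
  constructor pencil
  field
    members : Vec Hyp 4
    axis₁ axis₂ : V4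

-- The 130 pencils: the four hyperplanes through a line of PG(3,3), and two vectors spanning the line.
pencils : Vec Pencil 130
pencils =
    pencil (s 0 ∷ s 1 ∷ s 2 ∷ s 3 ∷ []) (v 𝟏 𝟎 𝟎 𝟎) (v 𝟎 𝟏 𝟎 𝟎)
  ∷ pencil (s 0 ∷ s 4 ∷ s 8 ∷ s 12 ∷ []) (v 𝟏 𝟎 𝟎 𝟎) (v 𝟎 𝟎 𝟏 𝟎)
  ∷ pencil (s 0 ∷ s 5 ∷ o 6 ∷ o 7 ∷ []) (v 𝟎 𝟏 𝟎 𝟎) (v 𝟎 𝟎 𝟏 𝟎)
  ∷ pencil (s 0 ∷ s 6 ∷ o 18 ∷ o 19 ∷ []) (v 𝟏 𝟏 𝟎 𝟎) (v 𝟎 𝟎 𝟏 𝟎)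
  ∷ pencil (s 0 ∷ s 7 ∷ o 12 ∷ o 13 ∷ []) (v 𝟏 𝟐 𝟎 𝟎) (v 𝟎 𝟎 𝟏 𝟎)
  ∷ pencil (s 0 ∷ s 9 ∷ o 10 ∷ o 11 ∷ []) (v 𝟏 𝟎 𝟏 𝟎) (v 𝟎 𝟏 𝟎 𝟎)
  ∷ pencil (s 0 ∷ s 10 ∷ o 22 ∷ o 23 ∷ []) (v 𝟏 𝟎 𝟏 𝟎) (v 𝟎 𝟏 𝟐 𝟎)
  ∷ pencil (s 0 ∷ s 11 ∷ o 16 ∷ o 17 ∷ []) (v 𝟏 𝟎 𝟏 𝟎) (v 𝟎 𝟏 𝟏 𝟎)
  ∷ pencil (s 0 ∷ s 13 ∷ o 8 ∷ o 9 ∷ []) (v 𝟏 𝟎 𝟐 𝟎) (v 𝟎 𝟏 𝟎 𝟎)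
  ∷ pencil (s 0 ∷ s 14 ∷ o 20 ∷ o 21 ∷ []) (v 𝟏 𝟎 𝟐 𝟎) (v 𝟎 𝟏 𝟏 𝟎)
  ∷ pencil (s 0 ∷ s 15 ∷ o 14 ∷ o 15 ∷ []) (v 𝟏 𝟎 𝟐 𝟎) (v 𝟎 𝟏 𝟐 𝟎)
  ∷ pencil (s 0 ∷ o 0 ∷ o 1 ∷ o 2 ∷ []) (v 𝟏 𝟎 𝟎 𝟎) (v 𝟎 𝟏 𝟐 𝟎)
  ∷ pencil (s 0 ∷ o 3 ∷ o 4 ∷ o 5 ∷ []) (v 𝟏 𝟎 𝟎 𝟎) (v 𝟎 𝟏 𝟏 𝟎)
  ∷ pencil (s 1 ∷ s 4 ∷ o 0 ∷ o 3 ∷ []) (v 𝟏 𝟎 𝟎 𝟎) (v 𝟎 𝟎 𝟎 𝟏)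
  ∷ pencil (s 1 ∷ s 5 ∷ s 9 ∷ s 13 ∷ []) (v 𝟎 𝟏 𝟎 𝟎) (v 𝟎 𝟎 𝟎 𝟏)
  ∷ pencil (s 1 ∷ s 6 ∷ o 20 ∷ o 22 ∷ []) (v 𝟏 𝟏 𝟎 𝟎) (v 𝟎 𝟎 𝟎 𝟏)
  ∷ pencil (s 1 ∷ s 7 ∷ o 14 ∷ o 16 ∷ []) (v 𝟏 𝟐 𝟎 𝟎) (v 𝟎 𝟎 𝟎 𝟏)
  ∷ pencil (s 1 ∷ s 8 ∷ o 2 ∷ o 5 ∷ []) (v 𝟏 𝟎 𝟎 𝟎) (v 𝟎 𝟏 𝟎 𝟏)
  ∷ pencil (s 1 ∷ s 10 ∷ o 18 ∷ o 21 ∷ []) (v 𝟏 𝟎 𝟎 𝟐) (v 𝟎 𝟏 𝟎 𝟏)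
  ∷ pencil (s 1 ∷ s 11 ∷ o 13 ∷ o 15 ∷ []) (v 𝟏 𝟎 𝟎 𝟏) (v 𝟎 𝟏 𝟎 𝟏)
  ∷ pencil (s 1 ∷ s 12 ∷ o 1 ∷ o 4 ∷ []) (v 𝟏 𝟎 𝟎 𝟎) (v 𝟎 𝟏 𝟎 𝟐)
  ∷ pencil (s 1 ∷ s 14 ∷ o 19 ∷ o 23 ∷ []) (v 𝟏 𝟎 𝟎 𝟏) (v 𝟎 𝟏 𝟎 𝟐)
  ∷ pencil (s 1 ∷ s 15 ∷ o 12 ∷ o 17 ∷ []) (v 𝟏 𝟎 𝟎 𝟐) (v 𝟎 𝟏 𝟎 𝟐)
  ∷ pencil (s 1 ∷ o 6 ∷ o 8 ∷ o 10 ∷ []) (v 𝟏 𝟎 𝟎 𝟐) (v 𝟎 𝟏 𝟎 𝟎)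
  ∷ pencil (s 1 ∷ o 7 ∷ o 9 ∷ o 11 ∷ []) (v 𝟏 𝟎 𝟎 𝟏) (v 𝟎 𝟏 𝟎 𝟎)
  ∷ pencil (s 2 ∷ s 4 ∷ o 2 ∷ o 4 ∷ []) (v 𝟏 𝟎 𝟎 𝟎) (v 𝟎 𝟎 𝟏 𝟏)
  ∷ pencil (s 2 ∷ s 5 ∷ o 9 ∷ o 10 ∷ []) (v 𝟎 𝟏 𝟎 𝟎) (v 𝟎 𝟎 𝟏 𝟏)
  ∷ pencil (s 2 ∷ s 6 ∷ s 10 ∷ s 14 ∷ []) (v 𝟏 𝟏 𝟎 𝟎) (v 𝟎 𝟎 𝟏 𝟏)
  ∷ pencil (s 2 ∷ s 7 ∷ o 15 ∷ o 17 ∷ []) (v 𝟏 𝟐 𝟎 𝟎) (v 𝟎 𝟎 𝟏 𝟏)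
  ∷ pencil (s 2 ∷ s 8 ∷ o 1 ∷ o 3 ∷ []) (v 𝟏 𝟎 𝟎 𝟎) (v 𝟎 𝟏 𝟏 𝟏)
  ∷ pencil (s 2 ∷ s 9 ∷ o 7 ∷ o 8 ∷ []) (v 𝟏 𝟎 𝟏 𝟏) (v 𝟎 𝟏 𝟎 𝟎)
  ∷ pencil (s 2 ∷ s 11 ∷ o 12 ∷ o 14 ∷ []) (v 𝟏 𝟎 𝟐 𝟐) (v 𝟎 𝟏 𝟐 𝟐)
  ∷ pencil (s 2 ∷ s 12 ∷ o 0 ∷ o 5 ∷ []) (v 𝟏 𝟎 𝟎 𝟎) (v 𝟎 𝟏 𝟐 𝟐)
  ∷ pencil (s 2 ∷ s 13 ∷ o 6 ∷ o 11 ∷ []) (v 𝟏 𝟎 𝟐 𝟐) (v 𝟎 𝟏 𝟎 𝟎)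
  ∷ pencil (s 2 ∷ s 15 ∷ o 13 ∷ o 16 ∷ []) (v 𝟏 𝟎 𝟏 𝟏) (v 𝟎 𝟏 𝟏 𝟏)
  ∷ pencil (s 2 ∷ o 18 ∷ o 20 ∷ o 23 ∷ []) (v 𝟏 𝟎 𝟐 𝟐) (v 𝟎 𝟏 𝟏 𝟏)
  ∷ pencil (s 2 ∷ o 19 ∷ o 21 ∷ o 22 ∷ []) (v 𝟏 𝟎 𝟏 𝟏) (v 𝟎 𝟏 𝟐 𝟐)
  ∷ pencil (s 3 ∷ s 4 ∷ o 1 ∷ o 5 ∷ []) (v 𝟏 𝟎 𝟎 𝟎) (v 𝟎 𝟎 𝟏 𝟐)
  ∷ pencil (s 3 ∷ s 5 ∷ o 8 ∷ o 11 ∷ []) (v 𝟎 𝟏 𝟎 𝟎) (v 𝟎 𝟎 𝟏 𝟐)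
  ∷ pencil (s 3 ∷ s 6 ∷ o 21 ∷ o 23 ∷ []) (v 𝟏 𝟏 𝟎 𝟎) (v 𝟎 𝟎 𝟏 𝟐)
  ∷ pencil (s 3 ∷ s 7 ∷ s 11 ∷ s 15 ∷ []) (v 𝟏 𝟐 𝟎 𝟎) (v 𝟎 𝟎 𝟏 𝟐)
  ∷ pencil (s 3 ∷ s 8 ∷ o 0 ∷ o 4 ∷ []) (v 𝟏 𝟎 𝟎 𝟎) (v 𝟎 𝟏 𝟐 𝟏)
  ∷ pencil (s 3 ∷ s 9 ∷ o 6 ∷ o 9 ∷ []) (v 𝟏 𝟎 𝟏 𝟐) (v 𝟎 𝟏 𝟎 𝟎)
  ∷ pencil (s 3 ∷ s 10 ∷ o 19 ∷ o 20 ∷ []) (v 𝟏 𝟎 𝟐 𝟏) (v 𝟎 𝟏 𝟏 𝟐)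
  ∷ pencil (s 3 ∷ s 12 ∷ o 2 ∷ o 3 ∷ []) (v 𝟏 𝟎 𝟎 𝟎) (v 𝟎 𝟏 𝟏 𝟐)
  ∷ pencil (s 3 ∷ s 13 ∷ o 7 ∷ o 10 ∷ []) (v 𝟏 𝟎 𝟐 𝟏) (v 𝟎 𝟏 𝟎 𝟎)
  ∷ pencil (s 3 ∷ s 14 ∷ o 18 ∷ o 22 ∷ []) (v 𝟏 𝟎 𝟏 𝟐) (v 𝟎 𝟏 𝟐 𝟏)
  ∷ pencil (s 3 ∷ o 12 ∷ o 15 ∷ o 16 ∷ []) (v 𝟏 𝟎 𝟏 𝟐) (v 𝟎 𝟏 𝟏 𝟐)
  ∷ pencil (s 3 ∷ o 13 ∷ o 14 ∷ o 17 ∷ []) (v 𝟏 𝟎 𝟐 𝟏) (v 𝟎 𝟏 𝟐 𝟏)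
  ∷ pencil (s 4 ∷ s 5 ∷ s 6 ∷ s 7 ∷ []) (v 𝟎 𝟎 𝟏 𝟎) (v 𝟎 𝟎 𝟎 𝟏)
  ∷ pencil (s 4 ∷ s 9 ∷ o 16 ∷ o 22 ∷ []) (v 𝟏 𝟎 𝟏 𝟎) (v 𝟎 𝟎 𝟎 𝟏)
  ∷ pencil (s 4 ∷ s 10 ∷ o 10 ∷ o 17 ∷ []) (v 𝟏 𝟎 𝟎 𝟐) (v 𝟎 𝟎 𝟏 𝟏)
  ∷ pencil (s 4 ∷ s 11 ∷ o 11 ∷ o 23 ∷ []) (v 𝟏 𝟎 𝟎 𝟏) (v 𝟎 𝟎 𝟏 𝟐)
  ∷ pencil (s 4 ∷ s 13 ∷ o 14 ∷ o 20 ∷ []) (v 𝟏 𝟎 𝟐 𝟎) (v 𝟎 𝟎 𝟎 𝟏)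
  ∷ pencil (s 4 ∷ s 14 ∷ o 9 ∷ o 15 ∷ []) (v 𝟏 𝟎 𝟎 𝟏) (v 𝟎 𝟎 𝟏 𝟏)
  ∷ pencil (s 4 ∷ s 15 ∷ o 8 ∷ o 21 ∷ []) (v 𝟏 𝟎 𝟎 𝟐) (v 𝟎 𝟎 𝟏 𝟐)
  ∷ pencil (s 4 ∷ o 6 ∷ o 12 ∷ o 18 ∷ []) (v 𝟏 𝟎 𝟎 𝟐) (v 𝟎 𝟎 𝟏 𝟎)
  ∷ pencil (s 4 ∷ o 7 ∷ o 13 ∷ o 19 ∷ []) (v 𝟏 𝟎 𝟎 𝟏) (v 𝟎 𝟎 𝟏 𝟎)
  ∷ pencil (s 5 ∷ s 8 ∷ o 13 ∷ o 18 ∷ []) (v 𝟎 𝟏 𝟎 𝟏) (v 𝟎 𝟎 𝟏 𝟎)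
  ∷ pencil (s 5 ∷ s 10 ∷ o 2 ∷ o 15 ∷ []) (v 𝟎 𝟏 𝟎 𝟏) (v 𝟎 𝟎 𝟏 𝟏)
  ∷ pencil (s 5 ∷ s 11 ∷ o 5 ∷ o 21 ∷ []) (v 𝟎 𝟏 𝟎 𝟏) (v 𝟎 𝟎 𝟏 𝟐)
  ∷ pencil (s 5 ∷ s 12 ∷ o 12 ∷ o 19 ∷ []) (v 𝟎 𝟏 𝟎 𝟐) (v 𝟎 𝟎 𝟏 𝟎)
  ∷ pencil (s 5 ∷ s 14 ∷ o 4 ∷ o 17 ∷ []) (v 𝟎 𝟏 𝟎 𝟐) (v 𝟎 𝟎 𝟏 𝟏)
  ∷ pencil (s 5 ∷ s 15 ∷ o 1 ∷ o 23 ∷ []) (v 𝟎 𝟏 𝟎 𝟐) (v 𝟎 𝟎 𝟏 𝟐)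
  ∷ pencil (s 5 ∷ o 0 ∷ o 14 ∷ o 22 ∷ []) (v 𝟎 𝟏 𝟐 𝟎) (v 𝟎 𝟎 𝟎 𝟏)
  ∷ pencil (s 5 ∷ o 3 ∷ o 16 ∷ o 20 ∷ []) (v 𝟎 𝟏 𝟏 𝟎) (v 𝟎 𝟎 𝟎 𝟏)
  ∷ pencil (s 6 ∷ s 8 ∷ o 7 ∷ o 12 ∷ []) (v 𝟏 𝟏 𝟎 𝟏) (v 𝟎 𝟎 𝟏 𝟎)
  ∷ pencil (s 6 ∷ s 9 ∷ o 3 ∷ o 14 ∷ []) (v 𝟏 𝟏 𝟏 𝟎) (v 𝟎 𝟎 𝟎 𝟏)
  ∷ pencil (s 6 ∷ s 11 ∷ o 1 ∷ o 8 ∷ []) (v 𝟏 𝟏 𝟎 𝟐) (v 𝟎 𝟎 𝟏 𝟐)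
  ∷ pencil (s 6 ∷ s 12 ∷ o 6 ∷ o 13 ∷ []) (v 𝟏 𝟏 𝟎 𝟐) (v 𝟎 𝟎 𝟏 𝟎)
  ∷ pencil (s 6 ∷ s 13 ∷ o 0 ∷ o 16 ∷ []) (v 𝟏 𝟏 𝟐 𝟎) (v 𝟎 𝟎 𝟎 𝟏)
  ∷ pencil (s 6 ∷ s 15 ∷ o 5 ∷ o 11 ∷ []) (v 𝟏 𝟏 𝟎 𝟏) (v 𝟎 𝟎 𝟏 𝟐)
  ∷ pencil (s 6 ∷ o 2 ∷ o 9 ∷ o 17 ∷ []) (v 𝟏 𝟏 𝟎 𝟏) (v 𝟎 𝟎 𝟏 𝟏)
  ∷ pencil (s 6 ∷ o 4 ∷ o 10 ∷ o 15 ∷ []) (v 𝟏 𝟏 𝟎 𝟐) (v 𝟎 𝟎 𝟏 𝟏)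
  ∷ pencil (s 7 ∷ s 8 ∷ o 6 ∷ o 19 ∷ []) (v 𝟏 𝟐 𝟎 𝟐) (v 𝟎 𝟎 𝟏 𝟎)
  ∷ pencil (s 7 ∷ s 9 ∷ o 0 ∷ o 20 ∷ []) (v 𝟏 𝟐 𝟏 𝟎) (v 𝟎 𝟎 𝟎 𝟏)
  ∷ pencil (s 7 ∷ s 10 ∷ o 4 ∷ o 9 ∷ []) (v 𝟏 𝟐 𝟎 𝟏) (v 𝟎 𝟎 𝟏 𝟏)
  ∷ pencil (s 7 ∷ s 12 ∷ o 7 ∷ o 18 ∷ []) (v 𝟏 𝟐 𝟎 𝟏) (v 𝟎 𝟎 𝟏 𝟎)
  ∷ pencil (s 7 ∷ s 13 ∷ o 3 ∷ o 22 ∷ []) (v 𝟏 𝟐 𝟐 𝟎) (v 𝟎 𝟎 𝟎 𝟏)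
  ∷ pencil (s 7 ∷ s 14 ∷ o 2 ∷ o 10 ∷ []) (v 𝟏 𝟐 𝟎 𝟐) (v 𝟎 𝟎 𝟏 𝟏)
  ∷ pencil (s 7 ∷ o 1 ∷ o 11 ∷ o 21 ∷ []) (v 𝟏 𝟐 𝟎 𝟏) (v 𝟎 𝟎 𝟏 𝟐)
  ∷ pencil (s 7 ∷ o 5 ∷ o 8 ∷ o 23 ∷ []) (v 𝟏 𝟐 𝟎 𝟐) (v 𝟎 𝟎 𝟏 𝟐)
  ∷ pencil (s 8 ∷ s 9 ∷ s 10 ∷ s 11 ∷ []) (v 𝟏 𝟎 𝟏 𝟎) (v 𝟎 𝟏 𝟎 𝟏)
  ∷ pencil (s 8 ∷ s 13 ∷ o 15 ∷ o 21 ∷ []) (v 𝟏 𝟎 𝟐 𝟎) (v 𝟎 𝟏 𝟎 𝟏)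
  ∷ pencil (s 8 ∷ s 14 ∷ o 8 ∷ o 14 ∷ []) (v 𝟏 𝟎 𝟐 𝟎) (v 𝟎 𝟏 𝟐 𝟏)
  ∷ pencil (s 8 ∷ s 15 ∷ o 9 ∷ o 20 ∷ []) (v 𝟏 𝟎 𝟐 𝟎) (v 𝟎 𝟏 𝟏 𝟏)
  ∷ pencil (s 8 ∷ o 10 ∷ o 16 ∷ o 23 ∷ []) (v 𝟏 𝟎 𝟏 𝟎) (v 𝟎 𝟏 𝟏 𝟏)
  ∷ pencil (s 8 ∷ o 11 ∷ o 17 ∷ o 22 ∷ []) (v 𝟏 𝟎 𝟏 𝟎) (v 𝟎 𝟏 𝟐 𝟏)
  ∷ pencil (s 9 ∷ s 12 ∷ o 17 ∷ o 23 ∷ []) (v 𝟏 𝟎 𝟏 𝟎) (v 𝟎 𝟏 𝟎 𝟐)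
  ∷ pencil (s 9 ∷ s 14 ∷ o 1 ∷ o 12 ∷ []) (v 𝟏 𝟎 𝟏 𝟐) (v 𝟎 𝟏 𝟎 𝟐)
  ∷ pencil (s 9 ∷ s 15 ∷ o 4 ∷ o 19 ∷ []) (v 𝟏 𝟎 𝟏 𝟏) (v 𝟎 𝟏 𝟎 𝟐)
  ∷ pencil (s 9 ∷ o 2 ∷ o 13 ∷ o 21 ∷ []) (v 𝟏 𝟎 𝟏 𝟏) (v 𝟎 𝟏 𝟎 𝟏)
  ∷ pencil (s 9 ∷ o 5 ∷ o 15 ∷ o 18 ∷ []) (v 𝟏 𝟎 𝟏 𝟐) (v 𝟎 𝟏 𝟎 𝟏)
  ∷ pencil (s 10 ∷ s 12 ∷ o 11 ∷ o 16 ∷ []) (v 𝟏 𝟎 𝟏 𝟎) (v 𝟎 𝟏 𝟏 𝟐)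
  ∷ pencil (s 10 ∷ s 13 ∷ o 5 ∷ o 13 ∷ []) (v 𝟏 𝟎 𝟐 𝟏) (v 𝟎 𝟏 𝟎 𝟏)
  ∷ pencil (s 10 ∷ s 15 ∷ o 0 ∷ o 6 ∷ []) (v 𝟏 𝟎 𝟎 𝟐) (v 𝟎 𝟏 𝟐 𝟎)
  ∷ pencil (s 10 ∷ o 1 ∷ o 7 ∷ o 14 ∷ []) (v 𝟏 𝟎 𝟐 𝟏) (v 𝟎 𝟏 𝟐 𝟎)
  ∷ pencil (s 10 ∷ o 3 ∷ o 8 ∷ o 12 ∷ []) (v 𝟏 𝟎 𝟎 𝟐) (v 𝟎 𝟏 𝟏 𝟐)
  ∷ pencil (s 11 ∷ s 12 ∷ o 10 ∷ o 22 ∷ []) (v 𝟏 𝟎 𝟏 𝟎) (v 𝟎 𝟏 𝟐 𝟐)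
  ∷ pencil (s 11 ∷ s 13 ∷ o 2 ∷ o 18 ∷ []) (v 𝟏 𝟎 𝟐 𝟐) (v 𝟎 𝟏 𝟎 𝟏)
  ∷ pencil (s 11 ∷ s 14 ∷ o 3 ∷ o 7 ∷ []) (v 𝟏 𝟎 𝟎 𝟏) (v 𝟎 𝟏 𝟏 𝟎)
  ∷ pencil (s 11 ∷ o 0 ∷ o 9 ∷ o 19 ∷ []) (v 𝟏 𝟎 𝟎 𝟏) (v 𝟎 𝟏 𝟐 𝟐)
  ∷ pencil (s 11 ∷ o 4 ∷ o 6 ∷ o 20 ∷ []) (v 𝟏 𝟎 𝟐 𝟐) (v 𝟎 𝟏 𝟏 𝟎)
  ∷ pencil (s 12 ∷ s 13 ∷ s 14 ∷ s 15 ∷ []) (v 𝟏 𝟎 𝟐 𝟎) (v 𝟎 𝟏 𝟎 𝟐)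
  ∷ pencil (s 12 ∷ o 8 ∷ o 15 ∷ o 20 ∷ []) (v 𝟏 𝟎 𝟐 𝟎) (v 𝟎 𝟏 𝟏 𝟐)
  ∷ pencil (s 12 ∷ o 9 ∷ o 14 ∷ o 21 ∷ []) (v 𝟏 𝟎 𝟐 𝟎) (v 𝟎 𝟏 𝟐 𝟐)
  ∷ pencil (s 13 ∷ o 1 ∷ o 17 ∷ o 19 ∷ []) (v 𝟏 𝟎 𝟐 𝟏) (v 𝟎 𝟏 𝟎 𝟐)
  ∷ pencil (s 13 ∷ o 4 ∷ o 12 ∷ o 23 ∷ []) (v 𝟏 𝟎 𝟐 𝟐) (v 𝟎 𝟏 𝟎 𝟐)
  ∷ pencil (s 14 ∷ o 0 ∷ o 11 ∷ o 13 ∷ []) (v 𝟏 𝟎 𝟎 𝟏) (v 𝟎 𝟏 𝟐 𝟏)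
  ∷ pencil (s 14 ∷ o 5 ∷ o 6 ∷ o 16 ∷ []) (v 𝟏 𝟎 𝟏 𝟐) (v 𝟎 𝟏 𝟏 𝟎)
  ∷ pencil (s 15 ∷ o 2 ∷ o 7 ∷ o 22 ∷ []) (v 𝟏 𝟎 𝟏 𝟏) (v 𝟎 𝟏 𝟐 𝟎)
  ∷ pencil (s 15 ∷ o 3 ∷ o 10 ∷ o 18 ∷ []) (v 𝟏 𝟎 𝟎 𝟐) (v 𝟎 𝟏 𝟏 𝟏)
  ∷ pencil (o 0 ∷ o 7 ∷ o 15 ∷ o 23 ∷ []) (v 𝟏 𝟎 𝟎 𝟏) (v 𝟎 𝟏 𝟐 𝟎)
  ∷ pencil (o 0 ∷ o 8 ∷ o 17 ∷ o 18 ∷ []) (v 𝟏 𝟎 𝟎 𝟐) (v 𝟎 𝟏 𝟐 𝟏)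
  ∷ pencil (o 0 ∷ o 10 ∷ o 12 ∷ o 21 ∷ []) (v 𝟏 𝟎 𝟎 𝟐) (v 𝟎 𝟏 𝟐 𝟐)
  ∷ pencil (o 1 ∷ o 6 ∷ o 15 ∷ o 22 ∷ []) (v 𝟏 𝟎 𝟏 𝟐) (v 𝟎 𝟏 𝟐 𝟎)
  ∷ pencil (o 1 ∷ o 9 ∷ o 16 ∷ o 18 ∷ []) (v 𝟏 𝟎 𝟏 𝟐) (v 𝟎 𝟏 𝟏 𝟏)
  ∷ pencil (o 1 ∷ o 10 ∷ o 13 ∷ o 20 ∷ []) (v 𝟏 𝟎 𝟐 𝟏) (v 𝟎 𝟏 𝟏 𝟏)
  ∷ pencil (o 2 ∷ o 6 ∷ o 14 ∷ o 23 ∷ []) (v 𝟏 𝟎 𝟐 𝟐) (v 𝟎 𝟏 𝟐 𝟎)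
  ∷ pencil (o 2 ∷ o 8 ∷ o 16 ∷ o 19 ∷ []) (v 𝟏 𝟎 𝟏 𝟏) (v 𝟎 𝟏 𝟏 𝟐)
  ∷ pencil (o 2 ∷ o 11 ∷ o 12 ∷ o 20 ∷ []) (v 𝟏 𝟎 𝟐 𝟐) (v 𝟎 𝟏 𝟏 𝟐)
  ∷ pencil (o 3 ∷ o 6 ∷ o 17 ∷ o 21 ∷ []) (v 𝟏 𝟎 𝟎 𝟐) (v 𝟎 𝟏 𝟏 𝟎)
  ∷ pencil (o 3 ∷ o 9 ∷ o 13 ∷ o 23 ∷ []) (v 𝟏 𝟎 𝟎 𝟏) (v 𝟎 𝟏 𝟏 𝟏)
  ∷ pencil (o 3 ∷ o 11 ∷ o 15 ∷ o 19 ∷ []) (v 𝟏 𝟎 𝟎 𝟏) (v 𝟎 𝟏 𝟏 𝟐)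
  ∷ pencil (o 4 ∷ o 7 ∷ o 16 ∷ o 21 ∷ []) (v 𝟏 𝟎 𝟏 𝟏) (v 𝟎 𝟏 𝟏 𝟎)
  ∷ pencil (o 4 ∷ o 8 ∷ o 13 ∷ o 22 ∷ []) (v 𝟏 𝟎 𝟏 𝟏) (v 𝟎 𝟏 𝟐 𝟏)
  ∷ pencil (o 4 ∷ o 11 ∷ o 14 ∷ o 18 ∷ []) (v 𝟏 𝟎 𝟐 𝟐) (v 𝟎 𝟏 𝟐 𝟏)
  ∷ pencil (o 5 ∷ o 7 ∷ o 17 ∷ o 20 ∷ []) (v 𝟏 𝟎 𝟐 𝟏) (v 𝟎 𝟏 𝟏 𝟎)
  ∷ pencil (o 5 ∷ o 9 ∷ o 12 ∷ o 22 ∷ []) (v 𝟏 𝟎 𝟏 𝟐) (v 𝟎 𝟏 𝟐 𝟐)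
  ∷ pencil (o 5 ∷ o 10 ∷ o 14 ∷ o 19 ∷ []) (v 𝟏 𝟎 𝟐 𝟏) (v 𝟎 𝟏 𝟐 𝟐)
  ∷ []
  where
  s : ∀ i {i<16} → Hyp
  s i {i<16} = inj₁ (#_ i {m<n = i<16})
  o : ∀ j {j<24} → Hyp
  o j {j<24} = inj₂ (#_ j {m<n = j<24})
  v : F3 → F3 → F3 → F3 → V4
  v x₀ x₁ x₂ x₃ = x₀ ∷ x₁ ∷ x₂ ∷ x₃ ∷ []

-- Six partitions of the point set into four ovoids, ovoid j standing for hyperplane (inj₂ j).
ovoidPartitions : Vec (Vec (Fin 24) 4) 6
ovoidPartitions =
    (# 0 ∷ # 7 ∷ # 17 ∷ # 21 ∷ [])
  ∷ (# 1 ∷ # 9 ∷ # 13 ∷ # 22 ∷ [])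
  ∷ (# 2 ∷ # 11 ∷ # 14 ∷ # 19 ∷ [])
  ∷ (# 3 ∷ # 6 ∷ # 15 ∷ # 23 ∷ [])
  ∷ (# 4 ∷ # 8 ∷ # 16 ∷ # 18 ∷ [])
  ∷ (# 5 ∷ # 10 ∷ # 12 ∷ # 20 ∷ [])
  ∷ []

VLine : Set
VLine = Fin 130 ⊎ Fin 6

member : VLine → Fin 4 → Hyp
member (inj₁ t) = lookup (Pencil.members (lookup pencils t))
member (inj₂ n) = inj₂ ∘ lookup (lookup ovoidPartitions n)

veldkampLine : VLine → Fin 4 → Sub
veldkampLine y i = hyperplane (member y i)

axis : Fin 130 → V4 × V4
axis t = Pencil.axis₁ (lookup pencils t) , Pencil.axis₂ (lookup pencils t)

_∈ᴸ_ : Hyp → VLine → Set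
x ∈ᴸ y = ∃ λ j → member y j ≡ x

_∈ᴸ?_ : ∀ x y → Dec (x ∈ᴸ y)
x ∈ᴸ? y = any? λ j → member y j ≟⊎ x

_∈ᴾ?_ : ∀ x p → Dec (∃ λ j → lookup (Pencil.members p) j ≡ x)
x ∈ᴾ? p = any? λ j → lookup (Pencil.members p) j ≟⊎ x

opaque
  member-distinct : ∀ y → Distinct (member y)
  member-distinct = from-yes (all⊎? λ y → distinct? _≟⊎_ (member y))

  veldkampLine-core : ∀ y i j → i ≢ j →
    veldkampLine y i ∩ˢ veldkampLine y j ≡ veldkampLine y (# 0) ∩ˢ veldkampLine y (# 1)
  veldkampLine-core = from-yes (all⊎? λ y → all? λ i → all? λ j → ¬? (i ≟ᶠ j) →-dec
    veldkampLine y i ∩ˢ veldkampLine y j ≟ˢ veldkampLine y (# 0) ∩ˢ veldkampLine y (# 1))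

  veldkampLine-cover : ∀ y p → ∃ λ i → p ∈ₛ veldkampLine y i
  veldkampLine-cover = from-yes (all⊎? λ y → allPoint? λ p → any? λ i → p ∈? veldkampLine y i)

veldkampLine-distinct : ∀ y → Distinct (veldkampLine y)
veldkampLine-distinct y i j i≢j = member-distinct y i j i≢j ∘ hyperplane-injective _ _

veldkampLine-isVeldkampLine : ∀ y → IsVeldkampLine (veldkampLine y)
veldkampLine-isVeldkampLine y = ∩ˢ-isVeldkampLine (hyperplane-isGeomHyperplane ∘ member y)
  (veldkampLine-distinct y) (veldkampLine-core y) (veldkampLine-cover y)

opaque
  pencil-axis : ∀ t → Independent (proj₁ (axis t)) (proj₂ (axis t)) ×
    (∀ i → dot (normal (member (inj₁ t) i)) (proj₁ (axis t)) ≡ 𝟎 ×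
           dot (normal (member (inj₁ t) i)) (proj₂ (axis t)) ≡ 𝟎)
  pencil-axis = from-yes (all? λ t → independent? (proj₁ (axis t)) (proj₂ (axis t)) ×-dec all? λ i →
    dot (normal (member (inj₁ t) i)) (proj₁ (axis t)) ≟₃ 𝟎 ×-dec
    dot (normal (member (inj₁ t) i)) (proj₂ (axis t)) ≟₃ 𝟎)

pencil-isProjective : ∀ t → IsProjectiveVeldkampLine (veldkampLine (inj₁ t))
pencil-isProjective t =
  let independent , annihilated = pencil-axis t
  in proj₁ (axis t) , proj₂ (axis t) , independent , normal ∘ member (inj₁ t) , λ i →
     normal≢0 (member (inj₁ t) i) , proj₁ (annihilated i) , proj₂ (annihilated i) ,
     ∈ₛ-section (normal (member (inj₁ t) i))

ovoidPartition-isOvoid : ∀ n k → IsOvoid (veldkampLine (inj₂ n) k)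
ovoidPartition-isOvoid n k = offQuadric-isOvoid (lookup (lookup ovoidPartitions n) k)

opaque
  ovoidPartition-disjoint : ∀ n k l → k ≢ l → ∀ p →
    ¬ (p ∈ₛ veldkampLine (inj₂ n) k × p ∈ₛ veldkampLine (inj₂ n) l)
  ovoidPartition-disjoint = from-yes (all? λ n → all? λ k → all? λ l → ¬? (k ≟ᶠ l) →-dec allPoint? λ p →
    ¬? (p ∈? veldkampLine (inj₂ n) k ×-dec p ∈? veldkampLine (inj₂ n) l))

  ovoidPartition-noAxis : ∀ n u w → (∀ k → dot (normal (member (inj₂ n) k)) u ≡ 𝟎 ×
                                           dot (normal (member (inj₂ n) k)) w ≡ 𝟎) → ¬ Independent u w
  ovoidPartition-noAxis = from-yes (all? λ n → allV4? λ u → allV4? λ w →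
    all? (λ k → dot (normal (member (inj₂ n) k)) u ≟₃ 𝟎 ×-dec dot (normal (member (inj₂ n) k)) w ≟₃ 𝟎)
    →-dec ¬? (independent? u w))

ovoidPartition-notProjective : ∀ n → ¬ IsProjectiveVeldkampLine (veldkampLine (inj₂ n))
ovoidPartition-notProjective n (u , w , independent , f , f-spec) =
  ovoidPartition-noAxis n u w annihilated independent
  where
  section-f : ∀ k → section (f k) ≡ veldkampLine (inj₂ n) k
  section-f k = ∈ₛ-injective λ p →
    ⇔.trans (∈ₛ-section (f k) p) (⇔.sym (proj₂ (proj₂ (proj₂ (f-spec k))) p))
  annihilated : ∀ k → dot (normal (member (inj₂ n) k)) u ≡ 𝟎 × dot (normal (member (inj₂ n) k)) w ≡ 𝟎
  annihilated k =
    section-annihilator {f k} {member (inj₂ n) k} (section-f k) (proj₁ (proj₂ (f-spec k))) ,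
    section-annihilator {f k} {member (inj₂ n) k} (section-f k) (proj₁ (proj₂ (proj₂ (f-spec k))))

opaque
  member-determines-line : ∀ y y′ → (∀ i → member y i ∈ᴸ y′) → y ≡ y′
  member-determines-line = from-yes (all⊎? λ y → all⊎? λ y′ →
    all? (λ i → member y i ∈ᴸ? y′) →-dec y ≟⊎ y′)

veldkampLine-SameSet⇒≡ : ∀ y y′ → SameSet (veldkampLine y) (veldkampLine y′) → y ≡ y′
veldkampLine-SameSet⇒≡ y y′ (listed , _) = member-determines-line y y′ λ i →
  let j , yi≡y′j = listed i in j , sym (hyperplane-injective (member y i) (member y′ j) yi≡y′j)

opaque
  pencil-through : ∀ a b → a ≢ b → ∃ λ t → a ∈ᴸ inj₁ t × b ∈ᴸ inj₁ t ×
                   ∀ c → normal c ∈⟨ normal a , normal b ⟩ → c ∈ᴸ inj₁ t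
  pencil-through = from-yes (all⊎? λ a → all⊎? λ b → ¬? (a ≟⊎ b) →-dec anyEntry? (λ p →
    a ∈ᴾ? p ×-dec b ∈ᴾ? p ×-dec all⊎? λ c → normal c ∈⟨ normal a , normal b ⟩? →-dec c ∈ᴾ? p) pencils)

  commonCore-classified : ∀ a b c → a ≢ b → a ≢ c → b ≢ c →
    hyperplane a ∩ˢ hyperplane c ≡ hyperplane a ∩ˢ hyperplane b →
    hyperplane b ∩ˢ hyperplane c ≡ hyperplane a ∩ˢ hyperplane b →
    normal c ∈⟨ normal a , normal b ⟩ ⊎ ∃ λ n → a ∈ᴸ inj₂ n × b ∈ᴸ inj₂ n × c ∈ᴸ inj₂ n
  commonCore-classified = from-yes (all⊎? λ a → all⊎? λ b → all⊎? λ c →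
    ¬? (a ≟⊎ b) →-dec ¬? (a ≟⊎ c) →-dec ¬? (b ≟⊎ c) →-dec
    hyperplane a ∩ˢ hyperplane c ≟ˢ hyperplane a ∩ˢ hyperplane b →-dec
    hyperplane b ∩ˢ hyperplane c ≟ˢ hyperplane a ∩ˢ hyperplane b →-dec
    (normal c ∈⟨ normal a , normal b ⟩? ⊎-dec any? λ n → a ∈ᴸ? inj₂ n ×-dec b ∈ᴸ? inj₂ n ×-dec c ∈ᴸ? inj₂ n))

commonCore-inLine : ∀ a b c → a ≢ b → a ≢ c → b ≢ c →
  hyperplane a ∩ˢ hyperplane c ≡ hyperplane a ∩ˢ hyperplane b →
  hyperplane b ∩ˢ hyperplane c ≡ hyperplane a ∩ˢ hyperplane b →
  ∃ λ y → a ∈ᴸ y × b ∈ᴸ y × c ∈ᴸ y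
commonCore-inLine a b c a≢b a≢c b≢c core₁ core₂ = inLine (commonCore-classified a b c a≢b a≢c b≢c core₁ core₂)
  where
  inLine : normal c ∈⟨ normal a , normal b ⟩ ⊎ (∃ λ n → a ∈ᴸ inj₂ n × b ∈ᴸ inj₂ n × c ∈ᴸ inj₂ n) →
           ∃ λ y → a ∈ᴸ y × b ∈ᴸ y × c ∈ᴸ y
  inLine (inj₁ c∈⟨a,b⟩) = let t , a∈t , b∈t , closed = pencil-through a b a≢b
                          in inj₁ t , a∈t , b∈t , closed c c∈⟨a,b⟩
  inLine (inj₂ (n , a∈n , b∈n , c∈n)) = inj₂ n , a∈n , b∈n , c∈n

veldkampLine-classification : ∀ {h} → IsVeldkampLine h → ∃ λ y → SameSet h (veldkampLine y)
veldkampLine-classification {h} V@(geom , h-distinct , _ , _) = classified (hyperplane-indices geom h-distinct)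
  where
  classified : (∃ λ x → Distinct x × ∀ i → h i ≡ hyperplane (x i)) → ∃ λ y → SameSet h (veldkampLine y)
  classified (x , x-distinct , h≡x) = sharing (commonCore-inLine (x (# 0)) (x (# 1)) (x (# 2))
    (x-distinct _ _ λ ()) (x-distinct _ _ λ ()) (x-distinct _ _ λ ()) (core (λ ()) (λ ())) (core (λ ()) (λ ())))
    where
    core : ∀ {i j k l} → i ≢ j → k ≢ l →
           hyperplane (x i) ∩ˢ hyperplane (x j) ≡ hyperplane (x k) ∩ˢ hyperplane (x l)
    core {i} {j} {k} {l} i≢j k≢l = trans (cong₂ _∩ˢ_ (sym (h≡x i)) (sym (h≡x j)))
      (trans (veldkamp-∩ˢ V i≢j k≢l) (cong₂ _∩ˢ_ (h≡x k) (h≡x l)))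
    sharing : (∃ λ y → x (# 0) ∈ᴸ y × x (# 1) ∈ᴸ y × x (# 2) ∈ᴸ y) → ∃ λ y → SameSet h (veldkampLine y)
    sharing (y , (_ , e₀) , (_ , e₁) , (_ , e₂)) =
      y , veldkamp-shareThree (veldkampLine-isVeldkampLine y) V (at e₀) (at e₁) (at e₂)
      where
      at : ∀ {i j} → member y j ≡ x i → h i ≡ veldkampLine y j
      at {i} yj≡xi = trans (h≡x i) (cong hyperplane (sym yj≡xi))

-- The junk value zero4 is chosen when H is not one of the forty hyperplanes.
normalOfChoice : ∀ {H} → Dec (∃ λ x → hyperplane x ≡ H) → V4
normalOfChoice (yes (x , _)) = normal x
normalOfChoice (no _)        = zero4

normalOf : Sub → V4
normalOf H = normalOfChoice (any⊎? λ x → hyperplane x ≟ˢ H)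

normalOfChoice-spec : ∀ {H x} → hyperplane x ≡ H → (found? : Dec (∃ λ x′ → hyperplane x′ ≡ H)) →
                      normalOfChoice found? ≡ normal x
normalOfChoice-spec {x = x} refl (yes (x′ , x′≡x)) = cong normal (hyperplane-injective x′ x x′≡x)
normalOfChoice-spec {x = x} refl (no none)         = contradiction (x , refl) none

-- Stated for a variable H, so that checking it never unfolds the search in normalOf.
normalOf-spec : ∀ H x → hyperplane x ≡ H → normalOf H ≡ normal x
normalOf-spec H x x≡H = normalOfChoice-spec {H} {x} x≡H (any⊎? λ x′ → hyperplane x′ ≟ˢ H)

normalOf-hyperplane : ∀ x → normalOf (hyperplane x) ≡ normal x
normalOf-hyperplane x = normalOf-spec (hyperplane x) x refl

normalOf≢0 : ∀ H → IsGeomHyperplane H → normalOf H ≢ zero4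
normalOf≢0 H geom normalOf≡0 =
  let x , x≡H = geomHyperplane-classification geom
  in normal≢0 x (trans (sym (normalOf-spec H x x≡H)) normalOf≡0)

normalOf-injective : ∀ H H′ → IsGeomHyperplane H → IsGeomHyperplane H′ →
                     Proportional (normalOf H) (normalOf H′) → H ≡ H′
normalOf-injective H H′ geom geom′ (α , α≢0 , H≡αH′) =
  let x , x≡H = geomHyperplane-classification geom
      x′ , x′≡H′ = geomHyperplane-classification geom′
      x≡x′ = normal-proportional⇒≡ x x′ (α , α≢0 ,
        trans (sym (normalOf-spec H x x≡H)) (trans H≡αH′ (cong (α ·_) (normalOf-spec H′ x′ x′≡H′))))
  in trans (sym x≡H) (trans (cong hyperplane x≡x′) x′≡H′)

normalOf-surjective : ∀ v → v ≢ zero4 → Σ Sub λ H → IsGeomHyperplane H × Proportional (normalOf H) v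
normalOf-surjective v v≢0 =
  let x , α , α≢0 , x≡αv = normal-surjective v v≢0
  in hyperplane x , hyperplane-isGeomHyperplane x , α , α≢0 , trans (normalOf-hyperplane x) x≡αv

opaque
  pencil-spanned : ∀ t k →
    normal (member (inj₁ t) k) ∈⟨ normal (member (inj₁ t) (# 0)) , normal (member (inj₁ t) (# 1)) ⟩
  pencil-spanned = from-yes (all? λ t → all? λ k →
    normal (member (inj₁ t) k) ∈⟨ normal (member (inj₁ t) (# 0)) , normal (member (inj₁ t) (# 1)) ⟩?)

projective⇒onCommonPGLine : ∀ {h} → IsVeldkampLine h → IsProjectiveVeldkampLine h →
                            OnCommonPGLine (normalOf ∘ h)
projective⇒onCommonPGLine {h} V projective = fromListed (veldkampLine-classification V)
  where
  fromListed : (∃ λ y → SameSet h (veldkampLine y)) → OnCommonPGLine (normalOf ∘ h)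
  fromListed (inj₂ n , _ , covered) = contradiction
    (relabel-isProjectiveVeldkampLine {h} {veldkampLine (inj₂ n)} (proj₁ ∘ covered) (proj₂ ∘ covered) projective)
    (ovoidPartition-notProjective n)
  fromListed (inj₁ t , listed , _) = normal (m (# 0)) , normal (m (# 1)) ,
    normal-independent (m (# 0)) (m (# 1)) (member-distinct (inj₁ t) (# 0) (# 1) λ ()) , spanned
    where
    m = member (inj₁ t)
    spanned : ∀ i → normalOf (h i) ∈⟨ normal (m (# 0)) , normal (m (# 1)) ⟩
    spanned i = let k , hi≡mk = listed i
                    α , β , mk≡αβ = pencil-spanned t k
                in α , β , trans (normalOf-spec (h i) (m k) (sym hi≡mk)) mk≡αβ

onCommonPGLine⇒projective : ∀ {h} → (∀ i → IsGeomHyperplane (h i)) → Distinct h →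
  OnCommonPGLine (normalOf ∘ h) → IsVeldkampLine h × IsProjectiveVeldkampLine h
onCommonPGLine⇒projective {h} geom h-distinct (u , w , _ , onLine) =
  inPencil (hyperplane-indices geom h-distinct)
  where
  inPencil : (∃ λ x → Distinct x × ∀ i → h i ≡ hyperplane (x i)) →
             IsVeldkampLine h × IsProjectiveVeldkampLine h
  inPencil (x , x-distinct , h≡x) = relabelled (pencil-through (x (# 0)) (x (# 1)) (x-distinct _ _ λ ()))
    where
    normal-onLine : ∀ i → normal (x i) ∈⟨ u , w ⟩
    normal-onLine i = let α , β , eq = onLine i
                      in α , β , trans (sym (normalOf-spec (h i) (x i) (sym (h≡x i)))) eq
    spanned : ∀ i → normal (x i) ∈⟨ normal (x (# 0)) , normal (x (# 1)) ⟩
    spanned i = span-exchange (normal-independent (x (# 0)) (x (# 1)) (x-distinct _ _ λ ()))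
                  (normal-onLine (# 0)) (normal-onLine (# 1)) (normal-onLine i)
    relabelled : (∃ λ t → x (# 0) ∈ᴸ inj₁ t × x (# 1) ∈ᴸ inj₁ t ×
                          ∀ c → normal c ∈⟨ normal (x (# 0)) , normal (x (# 1)) ⟩ → c ∈ᴸ inj₁ t) →
                 IsVeldkampLine h × IsProjectiveVeldkampLine h
    relabelled (t , _ , _ , closed) =
      relabel-isVeldkampLine {veldkampLine (inj₁ t)} {h} k h≡gk h-distinct (veldkampLine-isVeldkampLine (inj₁ t)) ,
      relabel-isProjectiveVeldkampLine {veldkampLine (inj₁ t)} {h} k h≡gk (pencil-isProjective t)
      where
      k : Fin 4 → Fin 4
      k i = proj₁ (closed (x i) (spanned i))
      h≡gk : ∀ i → h i ≡ veldkampLine (inj₁ t) (k i)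
      h≡gk i = trans (h≡x i) (cong hyperplane (sym (proj₂ (closed (x i) (spanned i)))))

[,]′-hyperplane : ∀ x → [ hyperplane ∘ inj₁ , hyperplane ∘ inj₂ ]′ x ≡ hyperplane x
[,]′-hyperplane (inj₁ _) = refl
[,]′-hyperplane (inj₂ _) = refl

[,]′-veldkampLine : ∀ y → [ veldkampLine ∘ inj₁ , veldkampLine ∘ inj₂ ]′ y ≡ veldkampLine y
[,]′-veldkampLine (inj₁ _) = refl
[,]′-veldkampLine (inj₂ _) = refl

geomHyperplanes-classified :
  Σ (Fin 16 → Sub) λ S → Σ (Fin 24 → Sub) λ O →
    (∀ i → IsSingular (S i)) × (∀ i → IsOvoid (O i)) ×
    (∀ x y → [ S , O ]′ x ≡ [ S , O ]′ y → x ≡ y) ×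
    (∀ H → (IsGeomHyperplane H ⇔ (Σ (Fin 16 ⊎ Fin 24) λ x → [ S , O ]′ x ≡ H)))
geomHyperplanes-classified =
  hyperplane ∘ inj₁ , hyperplane ∘ inj₂ , tangent-isSingular , offQuadric-isOvoid ,
  (λ x y eq → hyperplane-injective x y (trans (sym ([,]′-hyperplane x)) (trans eq ([,]′-hyperplane y)))) ,
  λ H → mk⇔ (λ geom → let x , x≡H = geomHyperplane-classification {H} geom
                      in x , trans ([,]′-hyperplane x) x≡H)
            (λ (x , x≡H) → subst IsGeomHyperplane (trans (sym ([,]′-hyperplane x)) x≡H)
                                  (hyperplane-isGeomHyperplane x))

geomHyperplane-isProjective : ∀ H → IsGeomHyperplane H → IsProjectiveHyperplane H
geomHyperplane-isProjective H geom =
  let x , x≡H = geomHyperplane-classification {H} geom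
  in subst IsProjectiveHyperplane x≡H (section-isProjective (normal x) (normal≢0 x))

veldkampLines-classified :
  Σ (Fin 130 → (Fin 4 → Sub)) λ P → Σ (Fin 6 → (Fin 4 → Sub)) λ N →
    (∀ i → IsVeldkampLine (P i) × IsProjectiveVeldkampLine (P i)) ×
    (∀ i → IsVeldkampLine (N i) × ¬ IsProjectiveVeldkampLine (N i) ×
           (∀ k → IsOvoid (N i k)) ×
           (∀ k l → k ≢ l → ∀ p → ¬ (p ∈ₛ N i k × p ∈ₛ N i l))) ×
    (∀ x y → SameSet ([ P , N ]′ x) ([ P , N ]′ y) → x ≡ y) ×
    (∀ h → IsVeldkampLine h → Σ (Fin 130 ⊎ Fin 6) λ x → SameSet h ([ P , N ]′ x))
veldkampLines-classified =
  veldkampLine ∘ inj₁ , veldkampLine ∘ inj₂ ,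
  (λ t → veldkampLine-isVeldkampLine (inj₁ t) , pencil-isProjective t) ,
  (λ n → veldkampLine-isVeldkampLine (inj₂ n) , ovoidPartition-notProjective n ,
         ovoidPartition-isOvoid n , ovoidPartition-disjoint n) ,
  (λ y y′ same → veldkampLine-SameSet⇒≡ y y′
    (subst₂ SameSet ([,]′-veldkampLine y) ([,]′-veldkampLine y′) same)) ,
  λ h V → let y , same = veldkampLine-classification V
          in y , subst (SameSet h) (sym ([,]′-veldkampLine y)) same

veldkampSpace≅PG33 :
  Σ (Sub → V4) λ φ →
    (∀ H → IsGeomHyperplane H → φ H ≢ zero4) ×
    (∀ H H′ → IsGeomHyperplane H → IsGeomHyperplane H′ → Proportional (φ H) (φ H′) → H ≡ H′) ×
    (∀ v → v ≢ zero4 → Σ Sub λ H → IsGeomHyperplane H × Proportional (φ H) v) ×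
    (∀ (h : Fin 4 → Sub) → (∀ i → IsGeomHyperplane (h i)) → (∀ i j → i ≢ j → h i ≢ h j) →
       ((IsVeldkampLine h × IsProjectiveVeldkampLine h) ⇔ OnCommonPGLine (φ ∘ h)))
veldkampSpace≅PG33 = normalOf , normalOf≢0 , normalOf-injective , normalOf-surjective ,
  λ h geom distinct → mk⇔ (λ (V , projective) → projective⇒onCommonPGLine V projective)
                          (onCommonPGLine⇒projective geom distinct)

mainTheorem1 :
    (Σ (Fin 16 → Sub) λ S → Σ (Fin 24 → Sub) λ O →
       (∀ i → IsSingular (S i)) × (∀ i → IsOvoid (O i)) ×
       (∀ x y → [ S , O ]′ x ≡ [ S , O ]′ y → x ≡ y) ×
       (∀ H → (IsGeomHyperplane H ⇔ (Σ (Fin 16 ⊎ Fin 24) λ x → [ S , O ]′ x ≡ H)))) ×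
    (∀ H → IsGeomHyperplane H → IsProjectiveHyperplane H) ×
    (Σ (Fin 130 → (Fin 4 → Sub)) λ P → Σ (Fin 6 → (Fin 4 → Sub)) λ N →
       (∀ i → IsVeldkampLine (P i) × IsProjectiveVeldkampLine (P i)) ×
       (∀ i → IsVeldkampLine (N i) × ¬ IsProjectiveVeldkampLine (N i) ×
              (∀ k → IsOvoid (N i k)) ×
              (∀ k l → k ≢ l → ∀ p → ¬ (p ∈ₛ N i k × p ∈ₛ N i l))) ×
       (∀ x y → SameSet ([ P , N ]′ x) ([ P , N ]′ y) → x ≡ y) ×
       (∀ h → IsVeldkampLine h → Σ (Fin 130 ⊎ Fin 6) λ x → SameSet h ([ P , N ]′ x))) ×
    (Σ (Sub → V4) λ φ →
       (∀ H → IsGeomHyperplane H → φ H ≢ zero4) ×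
       (∀ H H′ → IsGeomHyperplane H → IsGeomHyperplane H′ →
          Proportional (φ H) (φ H′) → H ≡ H′) ×
       (∀ v → v ≢ zero4 → Σ Sub λ H → IsGeomHyperplane H × Proportional (φ H) v) ×
       (∀ (h : Fin 4 → Sub) → (∀ i → IsGeomHyperplane (h i)) →
          (∀ i j → i ≢ j → h i ≢ h j) →
          ((IsVeldkampLine h × IsProjectiveVeldkampLine h) ⇔ OnCommonPGLine (φ ∘ h))))
mainTheorem1 =
  geomHyperplanes-classified , geomHyperplane-isProjective , veldkampLines-classified , veldkampSpace≅PG33
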